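{- Let $p \ge 5$ be a prime and let $a,b$ be integers with $\gcd(a,p)=1$ such that the cubic polynomial $x^3+ax+b$ is irreducible modulo $p$. Let $c_0,c_1,c_2$ be any integers such that $x^p \equiv c_2x^2+c_1x+c_0 \bmod \langle x^3+ax+b\rangle$ in $\mathbb{F}_p[x]$. Then $c_2$ is invertible modulo $p$, and setting $t \equiv (3a)(c_2)^{ -1} \pmod p$, we have \[ t^2 \equiv -(4a^3+27b^2) \pmod p. \]
   Context: Here $x^p \bmod \langle f \rangle$ denotes the remainder of $x^p$ upon division by $f$ in $\mathbb{F}_p[x]$, i.e. reduction in the quotient ring $\mathbb{F}_p[x]/\langle f\rangle$; coefficients are taken modulo $p$. -}

module Defs where

open import Data.Nat using (ℕ; zero; suc)
open import Data.Integer using (ℤ; +_; _+_; _*_; -_; _-_)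
open import Data.Integer.Divisibility using (_∣_)
open import Data.List using (List; []; _∷_; map; replicate; _++_)
open import Data.Product using (Σ; _×_)
open import Data.Sum using (_⊎_)
open import Relation.Nullary using (¬_)

infix 4 _≡_[mod_] _≈_[modₚ_] _≡_[modₚ_,_]
infixl 6 _+ₚ_ _-ₚ_
infixl 7 _*ₚ_

_≡_[mod_] : ℤ → ℤ → ℕ → Set
x ≡ y [mod p ] = (+ p) ∣ (x - y)

-- Polynomials with integer coefficients, lowest degree first.
-- They are viewed in F_p[x] via reduction of coefficients mod p.
Poly : Set
Poly = List ℤ

coeff : Poly → ℕ → ℤ
coeff []       _       = + 0
coeff (c ∷ cs) zero    = c
coeff (c ∷ cs) (suc i) = coeff cs i

_+ₚ_ : Poly → Poly → Poly
[]       +ₚ ys       = ys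
(x ∷ xs) +ₚ []       = x ∷ xs
(x ∷ xs) +ₚ (y ∷ ys) = (x + y) ∷ (xs +ₚ ys)

-ₚ_ : Poly → Poly
-ₚ xs = map -_ xs

_-ₚ_ : Poly → Poly → Poly
f -ₚ g = f +ₚ (-ₚ g)

_*ₚ_ : Poly → Poly → Poly
[]       *ₚ ys = []
(x ∷ xs) *ₚ ys = map (x *_) ys +ₚ (+ 0 ∷ (xs *ₚ ys))

X^ : ℕ → Poly
X^ n = replicate n (+ 0) ++ (+ 1 ∷ [])

_≈_[modₚ_] : Poly → Poly → ℕ → Set
f ≈ g [modₚ p ] = ∀ i → coeff f i ≡ coeff g i [mod p ]

IsUnitₚ : ℕ → Poly → Set
IsUnitₚ p g = Σ Poly (λ h → (g *ₚ h) ≈ (+ 1 ∷ []) [modₚ p ])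

IrreducibleModₚ : ℕ → Poly → Set
IrreducibleModₚ p f =
  (¬ (f ≈ [] [modₚ p ])) × (¬ IsUnitₚ p f) ×
  (∀ g h → f ≈ (g *ₚ h) [modₚ p ] → IsUnitₚ p g ⊎ IsUnitₚ p h)

_≡_[modₚ_,_] : Poly → Poly → ℕ → Poly → Set
g ≡ r [modₚ p , f ] = Σ Poly (λ q → (g -ₚ r) ≈ (q *ₚ f) [modₚ p ])

-- Let K = 𝔽ₚ[x]/(x³ + a x + b) and α the class of x.  As the cubic has no root in 𝔽ₚ,
-- K is an integral domain, and the Frobenius φ(y) = yᵖ is a ring endomorphism of K fixing 𝔽ₚ.
-- The hypothesis says φ(α) = u(α) for u(y) = c₂ y² + c₁ y + c₀.  Since α ∉ 𝔽ₚ, β = φ(α) is a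
-- second root of the cubic, and φ permutes the three roots α, β, γ = -(α + β) cyclically
-- (any other possibility forces a root in 𝔽ₚ); as φ commutes with u, u maps α ↦ β ↦ γ ↦ α.
-- The 3×3 determinant with rows (1, x, u x), x = α, β, γ, is then 3a on the one hand and
-- c₂ times the Vandermonde determinant V on the other, and V² = -(4a³ + 27b²).  Hence c₂ ≠ 0
-- and 3a / c₂ = V is a square root of the discriminant.

module Submission where

open import Algebra.Bundles using (CommutativeRing)
open import Algebra.Bundles.Raw using (RawRing)
import Algebra.Properties.Semiring.Mult as Mult
open import Data.Integer using (ℤ; +_)
open import Data.Nat using (ℕ; zero; suc)
open import Data.Nat.Divisibility using (_∣_; divides)
open import Data.Nat.Primality using (Prime)
open import Data.Product using (_,_; proj₁; proj₂; ∃-syntax)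
open import Defs using (_≡_[mod_])
open import Function using (_∘_)
open import Level using (0ℓ; _⊔_) renaming (suc to lsuc)
open import Relation.Binary.Core using (Rel; _⇒_)
open import Relation.Binary.PropositionalEquality as ≡ using (_≡_)
open import Relation.Binary.Structures using (IsEquivalence)

-- The Frobenius map in characteristic p

module _ where
  open import Data.Nat using (_+_; _*_; _<_)
  open import Data.Nat.Combinatorics using (_C_; nC1≡n; nCk+nC[k+1]≡[n+1]C[k+1])
  open import Data.Nat.Divisibility using (∣⇒≤)
  open import Data.Nat.Primality using (euclidsLemma)
  import Data.Nat.Properties as ℕ
  open import Data.Nat.Tactic.RingSolver using (solve-∀)
  open import Data.Sum using (inj₁; inj₂)
  open import Relation.Nullary using (contradiction)
  open ≡ using (cong; cong₂)

  [k+1]*[n+1]C[k+1]≡[n+1]*nCk : ∀ n k → suc k * (suc n C suc k) ≡ suc n * (n C k)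
  [k+1]*[n+1]C[k+1]≡[n+1]*nCk zero    zero    = ≡.refl
  [k+1]*[n+1]C[k+1]≡[n+1]*nCk zero    (suc k) = ℕ.*-zeroʳ (suc (suc k))
  [k+1]*[n+1]C[k+1]≡[n+1]*nCk (suc n) zero    = begin
    1 * (suc (suc n) C 1) ≡⟨ ℕ.*-identityˡ _ ⟩
    suc (suc n) C 1       ≡⟨ nC1≡n (suc (suc n)) ⟩
    suc (suc n)           ≡⟨ ℕ.*-identityʳ (suc (suc n)) ⟨
    suc (suc n) * 1       ∎
    where open ≡.≡-Reasoning
  [k+1]*[n+1]C[k+1]≡[n+1]*nCk (suc m) (suc j) = begin
    suc k * (suc n C suc k)                  ≡⟨ cong (suc k *_) (nCk+nC[k+1]≡[n+1]C[k+1] n k) ⟨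
    suc k * (n C k + n C suc k)              ≡⟨ expand k (n C k) (n C suc k) ⟩
    n C k + k * (n C k) + suc k * (n C suc k) ≡⟨ cong₂ (λ u v → n C k + u + v)
                                                 ([k+1]*[n+1]C[k+1]≡[n+1]*nCk m j)
                                                 ([k+1]*[n+1]C[k+1]≡[n+1]*nCk m k) ⟩
    n C k + n * (m C j) + n * (m C k)        ≡⟨ factor (n C k) n (m C j) (m C k) ⟩
    n C k + n * (m C j + m C k)
      ≡⟨ cong (λ u → n C k + n * u) (nCk+nC[k+1]≡[n+1]C[k+1] m j) ⟩
    suc n * (n C k)                          ∎
    where
    open ≡.≡-Reasoning
    n = suc m
    k = suc j
    expand : ∀ k x y → suc k * (x + y) ≡ x + k * x + suc k * y
    expand = solve-∀
    factor : ∀ x n u v → x + n * u + n * v ≡ x + n * (u + v)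
    factor = solve-∀

  prime∣pCk : ∀ {p k} → Prime p → 0 < k → k < p → p ∣ p C k
  prime∣pCk {suc n} {suc j} p-prime _ k<p
    with euclidsLemma (suc j) (suc n C suc j) p-prime
           (divides (n C j) (≡.trans ([k+1]*[n+1]C[k+1]≡[n+1]*nCk n j) (ℕ.*-comm (suc n) (n C j))))
  ... | inj₁ p∣k  = contradiction (∣⇒≤ p∣k) (ℕ.<⇒≱ k<p)
  ... | inj₂ p∣pCk = p∣pCk

CharacteristicDivides : ∀ {c ℓ} → CommutativeRing c ℓ → ℕ → Set ℓ
CharacteristicDivides R p = p × 1# ≈ 0#
  where
  open CommutativeRing R
  open Mult semiring using (_×_)

module Frobenius {c ℓ} (R : CommutativeRing c ℓ) {p : ℕ} (p-prime : Prime p)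
  (p×1≈0 : CharacteristicDivides R p) where

  open CommutativeRing R hiding (zero)
  open Mult semiring using (_×_; ×-congʳ; ×-assoc-*; ×1-homo-*)

  open import Data.Fin using (zero; suc; fromℕ; inject₁)
  open import Data.Fin.Properties using (toℕ-fromℕ; toℕ-inject₁; toℕ<n)
  open import Data.Nat using (pred; _<_; z≤n; s≤s)
  open import Data.Nat.Combinatorics using (nCn≡1)
  open import Data.Nat.Primality using (prime⇒nonZero)
  import Data.Nat as ℕ
  import Data.Nat.Properties as ℕ
  open import Algebra.Properties.CommutativeSemiring.Binomial commutativeSemiring
  open import Algebra.Properties.Semiring.Exp semiring using (_^_; ^-congˡ; ^-congʳ)
  open import Algebra.Properties.Monoid.Sum +-monoid
    using (sum; sum-init-last; sum-cong-≋; sum-replicate-zero)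
  open import Algebra.Properties.Group +-group using (inverseʳ-unique)
  open import Relation.Binary.Reasoning.Setoid setoid

  private
    1+[p-1]≡p : suc (pred p) ≡ p
    1+[p-1]≡p = ℕ.suc-pred p ⦃ prime⇒nonZero p-prime ⦄

    0#^p≈0# : 0# ^ p ≈ 0#
    0#^p≈0# = trans (^-congʳ 0# (≡.sym 1+[p-1]≡p)) (zeroˡ _)

    1#^n≈1# : ∀ n → 1# ^ n ≈ 1#
    1#^n≈1# zero    = refl
    1#^n≈1# (suc n) = trans (*-identityˡ _) (1#^n≈1# n)

  p∣m⇒m×x≈0# : ∀ {m} x → p ∣ m → m × x ≈ 0#
  p∣m⇒m×x≈0# x (divides q ≡.refl) = begin
    (q ℕ.* p) × x             ≈⟨ ×-congʳ (q ℕ.* p) (*-identityˡ x) ⟨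
    (q ℕ.* p) × (1# * x)      ≈⟨ ×-assoc-* (q ℕ.* p) 1# x ⟨
    ((q ℕ.* p) × 1#) * x      ≈⟨ *-congʳ (×1-homo-* q p) ⟩
    (q × 1#) * (p × 1#) * x   ≈⟨ *-congʳ (*-congˡ p×1≈0) ⟩
    (q × 1#) * 0# * x         ≈⟨ *-congʳ (zeroʳ _) ⟩
    0# * x                    ≈⟨ zeroˡ x ⟩
    0#                        ∎

  ^p-distrib-+ : ∀ x y → (x + y) ^ p ≈ x ^ p + y ^ p
  ^p-distrib-+ x y = expand (pred p) 1+[p-1]≡p
    where
    expand : ∀ n → suc n ≡ p → (x + y) ^ p ≈ x ^ p + y ^ p
    expand n ≡.refl = begin
      (x + y) ^ p                                   ≈⟨ theorem p x y ⟩
      first + sum (binomialTerm x y p ∘ suc)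
        ≈⟨ +-cong first≈y^p (sum-init-last (binomialTerm x y p ∘ suc)) ⟩
      y ^ p + (sum middle + last)
        ≈⟨ +-congˡ (+-congʳ (trans (sum-cong-≋ middle≈0#) (sum-replicate-zero n))) ⟩
      y ^ p + (0# + last)                           ≈⟨ +-congˡ (trans (+-identityˡ _) last≈x^p) ⟩
      y ^ p + x ^ p                                 ≈⟨ +-comm _ _ ⟩
      x ^ p + y ^ p                                 ∎
      where
      first = binomialTerm x y p zero
      middle = binomialTerm x y p ∘ suc ∘ inject₁
      last = binomialTerm x y p (suc (fromℕ n))

      first≈y^p : first ≈ y ^ p
      first≈y^p = trans (+-identityʳ _) (*-identityˡ _)

      middle≈0# : ∀ i → middle i ≈ 0#
      middle≈0# i = p∣m⇒m×x≈0# _ (prime∣pCk p-prime (s≤s z≤n)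
        (s≤s (≡.subst (_< n) (≡.sym (toℕ-inject₁ i)) (toℕ<n i))))

      last≈x^p : last ≈ x ^ p
      last≈x^p rewrite toℕ-fromℕ n | nCn≡1 p | ℕ.n∸n≡0 n = trans (+-identityʳ _) (*-identityʳ _)

  ^p-distrib-‿ : ∀ x → (- x) ^ p ≈ - (x ^ p)
  ^p-distrib-‿ x = inverseʳ-unique (x ^ p) ((- x) ^ p) (begin
    x ^ p + (- x) ^ p  ≈⟨ ^p-distrib-+ x (- x) ⟨
    (x + - x) ^ p      ≈⟨ ^-congˡ p (-‿inverseʳ x) ⟩
    0# ^ p             ≈⟨ 0#^p≈0# ⟩
    0#                 ∎)

  ^p-fixes-×1# : ∀ m → (m × 1#) ^ p ≈ m × 1#
  ^p-fixes-×1# zero    = 0#^p≈0#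
  ^p-fixes-×1# (suc m) = begin
    (1# + m × 1#) ^ p       ≈⟨ ^p-distrib-+ 1# (m × 1#) ⟩
    1# ^ p + (m × 1#) ^ p   ≈⟨ +-cong (1#^n≈1# p) (^p-fixes-×1# m) ⟩
    1# + m × 1#             ∎

-- Roots of polynomials over a ring without zero divisors

NoZeroDivisors : ∀ {c ℓ} → CommutativeRing c ℓ → Set (c ⊔ ℓ)
NoZeroDivisors R = ∀ {x y} → x ≉ 0# → x * y ≈ 0# → y ≈ 0#
  where open CommutativeRing R

module RootBound {c ℓ} (R : CommutativeRing c ℓ) (cancel : NoZeroDivisors R) where

  open CommutativeRing R hiding (zero)

  open import Algebra.Properties.Group +-group using (x∙y⁻¹≈ε⇒x≈y)
  open import Algebra.Solver.Ring.NaturalCoefficients.Default commutativeSemiring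
    using (solve; _:=_; _:+_; _:*_; con)
  open import Data.List using (List; []; _∷_; length)
  open import Data.List.Relation.Unary.All using (All; []; _∷_)
  open import Data.List.Relation.Unary.AllPairs using (AllPairs; []; _∷_)
  open import Data.Nat using (_≤_; s≤s)
  open import Relation.Binary.Reasoning.Setoid setoid

  eval : List Carrier → Carrier → Carrier
  eval []       y = 0#
  eval (c ∷ cs) y = c + y * eval cs y

  eval-congʳ : ∀ cs {y z} → y ≈ z → eval cs y ≈ eval cs z
  eval-congʳ []       y≈z = refl
  eval-congʳ (c ∷ cs) y≈z = +-congˡ (*-cong y≈z (eval-congʳ cs y≈z))

  divide : Carrier → List Carrier → List Carrier
  divide r []            = []
  divide r (c ∷ [])      = []
  divide r (c ∷ c′ ∷ cs) = eval (c′ ∷ cs) r ∷ divide r (c′ ∷ cs)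

  length-divide : ∀ r c cs → length (divide r (c ∷ cs)) ≡ length cs
  length-divide r c []        = ≡.refl
  length-divide r c (c′ ∷ cs) = ≡.cong suc (length-divide r c′ cs)

  factor-theorem : ∀ r d cs → eval cs (r + d) ≈ eval cs r + d * eval (divide r cs) (r + d)
  factor-theorem r d []            = solve 1 (λ d → con 0 := con 0 :+ d :* con 0) refl d
  factor-theorem r d (c ∷ [])      =
    solve 3 (λ c r d → c :+ (r :+ d) :* con 0 := c :+ r :* con 0 :+ d :* con 0) refl c r d
  factor-theorem r d (c ∷ c′ ∷ cs) = begin
    c + (r + d) * eval (c′ ∷ cs) (r + d)
      ≈⟨ +-congˡ (*-congˡ (factor-theorem r d (c′ ∷ cs))) ⟩
    c + (r + d) * (e + d * q)
      ≈⟨ solve 5 (λ c r d e q → c :+ (r :+ d) :* (e :+ d :* q) := c :+ r :* e :+ d :* (e :+ (r :+ d) :* q))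
                 refl c r d e q ⟩
    c + r * e + d * (e + (r + d) * q)               ∎
    where
    e = eval (c′ ∷ cs) r
    q = eval (divide r (c′ ∷ cs)) (r + d)

  root-of-quotient : ∀ {r s} cs → s ≉ r → eval cs r ≈ 0# → eval cs s ≈ 0# → eval (divide r cs) s ≈ 0#
  root-of-quotient {r} {s} cs s≉r cs[r]≈0 cs[s]≈0 = cancel s-r≉0 (begin
    (s - r) * eval (divide r cs) s                     ≈⟨ *-congˡ (eval-congʳ (divide r cs) r+[s-r]≈s) ⟨
    (s - r) * eval (divide r cs) (r + (s - r))         ≈⟨ +-identityˡ _ ⟨
    0# + (s - r) * eval (divide r cs) (r + (s - r))    ≈⟨ +-congʳ cs[r]≈0 ⟨
    eval cs r + (s - r) * eval (divide r cs) (r + (s - r)) ≈⟨ factor-theorem r (s - r) cs ⟨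
    eval cs (r + (s - r))                              ≈⟨ eval-congʳ cs r+[s-r]≈s ⟩
    eval cs s                                          ≈⟨ cs[s]≈0 ⟩
    0#                                                 ∎)
    where
    s-r≉0 : s - r ≉ 0#
    s-r≉0 = s≉r ∘ x∙y⁻¹≈ε⇒x≈y s r
    r+[s-r]≈s : r + (s - r) ≈ s
    r+[s-r]≈s = begin
      r + (s - r)    ≈⟨ +-comm r (s - r) ⟩
      s - r + r      ≈⟨ +-assoc s (- r) r ⟩
      s + (- r + r)  ≈⟨ +-congˡ (-‿inverseˡ r) ⟩
      s + 0#         ≈⟨ +-identityʳ s ⟩
      s              ∎

  coefficients-vanish : ∀ {r} cs → All (_≈ 0#) (divide r cs) → eval cs r ≈ 0# → All (_≈ 0#) cs
  coefficients-vanish []                  _              _          = []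
  coefficients-vanish {r} (c ∷ [])        _              c+r*0≈0    = c≈0 ∷ []
    where
    c≈0 = trans (solve 2 (λ c r → c := c :+ r :* con 0) refl c r) c+r*0≈0
  coefficients-vanish {r} (c ∷ c′ ∷ cs) (e≈0 ∷ q≈0) c+r*e≈0 = c≈0 ∷ coefficients-vanish (c′ ∷ cs) q≈0 e≈0
    where
    c≈0 = begin
      c                            ≈⟨ solve 2 (λ c r → c := c :+ r :* con 0) refl c r ⟩
      c + r * 0#                   ≈⟨ +-congˡ (*-congˡ e≈0) ⟨
      c + r * eval (c′ ∷ cs) r     ≈⟨ c+r*e≈0 ⟩
      0#                           ∎

  root-bound : ∀ cs rs → AllPairs _≉_ rs → length cs ≤ length rs →
               All (λ r → eval cs r ≈ 0#) rs → All (_≈ 0#) cs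
  root-bound []       rs       _             _         _ = []
  root-bound (c ∷ cs) (r ∷ rs) (r≉rs ∷ rs≉) (s≤s |cs|≤|rs|) (cs[r]≈0 ∷ cs[rs]≈0) =
    coefficients-vanish (c ∷ cs)
      (root-bound (divide r (c ∷ cs)) rs rs≉
        (≡.subst (_≤ length rs) (≡.sym (length-divide r c cs)) |cs|≤|rs|)
        (roots-of-quotient r≉rs cs[rs]≈0))
      cs[r]≈0
    where
    roots-of-quotient : ∀ {ss} → All (r ≉_) ss → All (λ s → eval (c ∷ cs) s ≈ 0#) ss →
                        All (λ s → eval (divide r (c ∷ cs)) s ≈ 0#) ss
    roots-of-quotient []                  []                 = []
    roots-of-quotient (r≉s ∷ r≉ss) (cs[s]≈0 ∷ cs[ss]≈0) =
      root-of-quotient (c ∷ cs) (r≉s ∘ sym) cs[r]≈0 cs[s]≈0 ∷ roots-of-quotient r≉ss cs[ss]≈0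

-- Integers modulo n

record RingCongruence {c ℓ} (R : CommutativeRing c ℓ) ℓ′ : Set (c ⊔ ℓ ⊔ lsuc ℓ′) where
  open CommutativeRing R
  field
    _∼_           : Rel Carrier ℓ′
    isEquivalence : IsEquivalence _∼_
    ≈⇒∼           : _≈_ ⇒ _∼_
    +-cong        : ∀ {x y u v} → x ∼ y → u ∼ v → (x + u) ∼ (y + v)
    *-cong        : ∀ {x y u v} → x ∼ y → u ∼ v → (x * u) ∼ (y * v)
    -‿cong        : ∀ {x y} → x ∼ y → (- x) ∼ (- y)

quotientRing : ∀ {c ℓ ℓ′} {R : CommutativeRing c ℓ} → RingCongruence R ℓ′ → CommutativeRing c ℓ′
quotientRing {R = R} ∼ = record
  { Carrier = Carrier ; _≈_ = _∼_ ; _+_ = _+_ ; _*_ = _*_ ; -_ = -_ ; 0# = 0# ; 1# = 1#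
  ; isCommutativeRing = record
    { isRing = record
      { +-isAbelianGroup = record
        { isGroup = record
          { isMonoid = record
            { isSemigroup = record
              { isMagma = record { isEquivalence = isEquivalence ; ∙-cong = ∼.+-cong }
              ; assoc = λ x y z → ≈⇒∼ (+-assoc x y z) }
            ; identity = ≈⇒∼ ∘ +-identityˡ , ≈⇒∼ ∘ +-identityʳ }
          ; inverse = ≈⇒∼ ∘ -‿inverseˡ , ≈⇒∼ ∘ -‿inverseʳ
          ; ⁻¹-cong = ∼.-‿cong }
        ; comm = λ x y → ≈⇒∼ (+-comm x y) }
      ; *-cong = ∼.*-cong
      ; *-assoc = λ x y z → ≈⇒∼ (*-assoc x y z)
      ; *-identity = ≈⇒∼ ∘ *-identityˡ , ≈⇒∼ ∘ *-identityʳ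
      ; distrib = (λ x y z → ≈⇒∼ (distribˡ x y z)) , (λ x y z → ≈⇒∼ (distribʳ x y z)) }
    ; *-comm = λ x y → ≈⇒∼ (*-comm x y) } }
  where
  open CommutativeRing R hiding (isEquivalence)
  module ∼ = RingCongruence ∼
  open ∼ using (_∼_; isEquivalence; ≈⇒∼)

module Congruence (n : ℕ) where
  open import Data.Integer using (_+_; _*_; -_; _-_)
  import Data.Integer.Divisibility.Signed as S
  open import Data.Integer.Properties using (+-*-commutativeRing)
  open import Data.Integer.Tactic.RingSolver using (solve-∀)
  open import Relation.Nullary using (¬_)

  -- A record, unlike the bare divisibility statement, lets Agda infer x and y.
  infix 4 _≈ₙ_
  record _≈ₙ_ (x y : ℤ) : Set where
    constructor mod
    field
      unmod : x ≡ y [mod n ]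
  open _≈ₙ_ public

  private
    by-divisibility : ∀ {x y} z → x - y ≡ z → + n S.∣ z → x ≈ₙ y
    by-divisibility z x-y≡z n∣z = mod (S.∣⇒∣ᵤ (≡.subst (+ n S.∣_) (≡.sym x-y≡z) n∣z))

    difference-divisible : ∀ {x y} → x ≈ₙ y → + n S.∣ (x - y)
    difference-divisible (mod x≡y) = S.∣ᵤ⇒∣ x≡y

  ≈ₙ-refl : ∀ {x} → x ≈ₙ x
  ≈ₙ-refl {x} = by-divisibility (+ 0) (x-x≡0 x) (S.divides (+ 0) ≡.refl)
    where
    x-x≡0 : ∀ x → x - x ≡ + 0
    x-x≡0 = solve-∀

  ≈ₙ-sym : ∀ {x y} → x ≈ₙ y → y ≈ₙ x
  ≈ₙ-sym {x} {y} x≈y = by-divisibility _ (y-x≡-[x-y] x y) (S.∣m⇒∣-m (difference-divisible x≈y))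
    where
    y-x≡-[x-y] : ∀ x y → y - x ≡ - (x - y)
    y-x≡-[x-y] = solve-∀

  ≈ₙ-trans : ∀ {x y z} → x ≈ₙ y → y ≈ₙ z → x ≈ₙ z
  ≈ₙ-trans {x} {y} {z} x≈y y≈z =
    by-divisibility _ (telescope x y z) (S.∣m∣n⇒∣m+n (difference-divisible x≈y) (difference-divisible y≈z))
    where
    telescope : ∀ x y z → x - z ≡ (x - y) + (y - z)
    telescope = solve-∀

  ≡⇒≈ₙ : ∀ {x y} → x ≡ y → x ≈ₙ y
  ≡⇒≈ₙ ≡.refl = ≈ₙ-refl

  +-cong-≈ₙ : ∀ {x y u v} → x ≈ₙ y → u ≈ₙ v → x + u ≈ₙ y + v
  +-cong-≈ₙ {x} {y} {u} {v} x≈y u≈v =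
    by-divisibility _ (regroup x y u v) (S.∣m∣n⇒∣m+n (difference-divisible x≈y) (difference-divisible u≈v))
    where
    regroup : ∀ x y u v → (x + u) - (y + v) ≡ (x - y) + (u - v)
    regroup = solve-∀

  *-cong-≈ₙ : ∀ {x y u v} → x ≈ₙ y → u ≈ₙ v → x * u ≈ₙ y * v
  *-cong-≈ₙ {x} {y} {u} {v} x≈y u≈v = by-divisibility _ (regroup x y u v)
    (S.∣m∣n⇒∣m+n (S.∣m⇒∣m*n u (difference-divisible x≈y)) (S.∣n⇒∣m*n y (difference-divisible u≈v)))
    where
    regroup : ∀ x y u v → x * u - y * v ≡ (x - y) * u + y * (u - v)
    regroup = solve-∀

  -‿cong-≈ₙ : ∀ {x y} → x ≈ₙ y → - x ≈ₙ - y
  -‿cong-≈ₙ {x} {y} x≈y = by-divisibility _ (regroup x y) (S.∣m⇒∣-m (difference-divisible x≈y))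
    where
    regroup : ∀ x y → - x - - y ≡ - (x - y)
    regroup = solve-∀

  ℤ/nℤ : CommutativeRing 0ℓ 0ℓ
  ℤ/nℤ = quotientRing {R = +-*-commutativeRing} (record
    { _∼_ = _≈ₙ_ ; isEquivalence = record { refl = ≈ₙ-refl ; sym = ≈ₙ-sym ; trans = ≈ₙ-trans }
    ; ≈⇒∼ = ≡⇒≈ₙ ; +-cong = +-cong-≈ₙ ; *-cong = *-cong-≈ₙ ; -‿cong = -‿cong-≈ₙ })

  NoRootOfCubic : ℤ → ℤ → Set
  NoRootOfCubic a b = ∀ s → ¬ s * s * s + a * s + b ≈ₙ + 0

module PrimeModulus (p : ℕ) (p-prime : Prime p) where
  open Congruence p public
  open import Algebra.Properties.Semiring.Exp (CommutativeRing.semiring ℤ/nℤ) using (_^_)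
  open import Data.Integer using (_+_; _*_; _-_; -_; ∣_∣; -[1+_])
  open import Data.Integer.GCD using (gcd)
  import Data.Integer.Properties as ℤ
  open import Data.Integer.Tactic.RingSolver using (solve-∀)
  open import Data.Nat using (_<_; _∸_; >-nonZero; nonTrivial⇒≢1; nonTrivial⇒n>1)
  open import Data.Nat.Divisibility using (_∣?_; ∣1⇒≡1; ∣-refl; ∣⇒≤)
  open import Data.Nat.GCD using (gcd-greatest)
  open import Data.Nat.Primality using (euclidsLemma; prime⇒nonTrivial)
  import Data.Nat.Properties as ℕ
  open import Data.Sum as Sum using (_⊎_; [_,_]′)
  open import Relation.Nullary using (Dec; ¬_; contradiction)
  import Relation.Nullary.Decidable as Dec
  open Mult (CommutativeRing.semiring ℤ/nℤ) using (_×_)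

  private
    instance
      p-nonTrivial = prime⇒nonTrivial p-prime

  ≈0⇒p∣ : ∀ {x} → x ≈ₙ + 0 → p ∣ ∣ x ∣
  ≈0⇒p∣ {x} (mod p∣x-0) = ≡.subst (λ z → p ∣ ∣ z ∣) (ℤ.+-identityʳ x) p∣x-0

  p∣⇒≈0 : ∀ {x} → p ∣ ∣ x ∣ → x ≈ₙ + 0
  p∣⇒≈0 {x} p∣x = mod (≡.subst (λ z → p ∣ ∣ z ∣) (≡.sym (ℤ.+-identityʳ x)) p∣x)

  infix 4 _≈ₙ?_
  _≈ₙ?_ : ∀ x y → Dec (x ≈ₙ y)
  x ≈ₙ? y = Dec.map′ mod unmod (p ∣? ∣ x - y ∣)

  1≉0 : ¬ + 1 ≈ₙ + 0
  1≉0 = nonTrivial⇒≢1 ∘ ∣1⇒≡1 ∘ ≈0⇒p∣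

  x*y≈0⇒x≈0⊎y≈0 : ∀ x y → x * y ≈ₙ + 0 → x ≈ₙ + 0 ⊎ y ≈ₙ + 0
  x*y≈0⇒x≈0⊎y≈0 x y xy≈0 = Sum.map p∣⇒≈0 p∣⇒≈0
    (euclidsLemma ∣ x ∣ ∣ y ∣ p-prime (≡.subst (p ∣_) (ℤ.abs-* x y) (≈0⇒p∣ xy≈0)))

  0<n<p⇒p∤n : ∀ {n} → 0 < n → n < p → ¬ p ∣ n
  0<n<p⇒p∤n 0<n n<p p∣n = ℕ.<⇒≱ n<p (∣⇒≤ ⦃ >-nonZero 0<n ⦄ p∣n)

  distinct-residues : ∀ {i j} → i < j → j < p → ¬ + j ≈ₙ + i
  distinct-residues {i} {j} i<j j<p (mod p∣j-i) =
    0<n<p⇒p∤n (ℕ.m<n⇒0<n∸m i<j) (ℕ.≤-<-trans (ℕ.m∸n≤m j i) j<p)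
      (≡.subst (λ z → p ∣ ∣ z ∣) (≡.trans (ℤ.m-n≡m⊖n j i) (ℤ.⊖-≥ (ℕ.<⇒≤ i<j))) p∣j-i)

  m×1≡m : ∀ m → m × + 1 ≡ + m
  m×1≡m zero    = ≡.refl
  m×1≡m (suc m) = ≡.cong (λ z → + 1 + z) (m×1≡m m)

  p×1≈0 : p × + 1 ≈ₙ + 0
  p×1≈0 = ≈ₙ-trans (≡⇒≈ₙ (m×1≡m p)) (p∣⇒≈0 ∣-refl)

  open Frobenius ℤ/nℤ p-prime p×1≈0 using (^p-fixes-×1#; ^p-distrib-‿)

  fermat : ∀ x → x ^ p ≈ₙ x
  fermat (+ m)    = ≡.subst (λ z → z ^ p ≈ₙ z) (m×1≡m m) (^p-fixes-×1# m)
  fermat -[1+ m ] = ≈ₙ-trans (^p-distrib-‿ (+ suc m)) (-‿cong-≈ₙ (fermat (+ suc m)))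

  inverse : ∀ {x} → ¬ x ≈ₙ + 0 → ∃[ y ] x * y ≈ₙ + 1
  inverse {x} x≉0 = y , x*y≈1
    where
    y = x ^ (p ∸ 2)
    x*[x*y]≈x : x * (x * y) ≈ₙ x
    x*[x*y]≈x = ≡.subst (λ n → x ^ n ≈ₙ x) (≡.sym (ℕ.m+[n∸m]≡n (nonTrivial⇒n>1 p))) (fermat x)
    x*[x*y-1]≈0 : x * (x * y - + 1) ≈ₙ + 0
    x*[x*y-1]≈0 = ≈ₙ-trans (≡⇒≈ₙ (factor x y))
      (≈ₙ-trans (+-cong-≈ₙ x*[x*y]≈x ≈ₙ-refl) (≡⇒≈ₙ (ℤ.+-inverseʳ x)))
      where
      factor : ∀ x y → x * (x * y - + 1) ≡ x * (x * y) - x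
      factor = solve-∀
    x*y≈1 : x * y ≈ₙ + 1
    x*y≈1 = [ (λ x≈0 → contradiction x≈0 x≉0) , add-one ]′ (x*y≈0⇒x≈0⊎y≈0 x (x * y - + 1) x*[x*y-1]≈0)
      where
      shift : ∀ z → z ≡ (z - + 1) + + 1
      shift = solve-∀
      add-one : x * y - + 1 ≈ₙ + 0 → x * y ≈ₙ + 1
      add-one x*y-1≈0 = ≈ₙ-trans (≡⇒≈ₙ (shift (x * y))) (+-cong-≈ₙ x*y-1≈0 ≈ₙ-refl)

  coprime⇒≉0 : ∀ {x} → gcd x (+ p) ≡ + 1 → ¬ x ≈ₙ + 0
  coprime⇒≉0 gcd≡1 x≈0 =
    nonTrivial⇒≢1 (∣1⇒≡1 (≡.subst (p ∣_) (≡.cong ∣_∣ gcd≡1) (gcd-greatest (≈0⇒p∣ x≈0) ∣-refl)))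

-- Irreducible cubics modulo p have no roots

module IntegerPolynomials (p : ℕ) (p-prime : Prime p) where
  open PrimeModulus p p-prime
  open import Data.Integer using (_+_; _*_; -_; _-_)
  import Data.Integer.Properties as ℤ
  open import Data.Integer.Tactic.RingSolver using (solve-∀)
  open import Data.List using ([]; _∷_; _++_; map; length)
  open import Data.Nat using (_≤_; _<_; s≤s)
  import Data.Nat as ℕ
  import Data.Nat.Properties as ℕ
  open import Data.Sum using ([_,_]′)
  open import Defs using (coeff; _+ₚ_; _*ₚ_; IsUnitₚ; IrreducibleModₚ)
  open import Relation.Nullary using (¬_)
  open import Relation.Binary.Reasoning.Setoid (CommutativeRing.setoid ℤ/nℤ)

  coeff-+ₚ : ∀ xs ys i → coeff (xs +ₚ ys) i ≡ coeff xs i + coeff ys i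
  coeff-+ₚ []       ys       i       = ≡.sym (ℤ.+-identityˡ (coeff ys i))
  coeff-+ₚ (x ∷ xs) []       i       = ≡.sym (ℤ.+-identityʳ (coeff (x ∷ xs) i))
  coeff-+ₚ (x ∷ xs) (y ∷ ys) zero    = ≡.refl
  coeff-+ₚ (x ∷ xs) (y ∷ ys) (suc i) = coeff-+ₚ xs ys i

  coeff-map : ∀ c xs i → coeff (map (c *_) xs) i ≡ c * coeff xs i
  coeff-map c []       i       = ≡.sym (ℤ.*-zeroʳ c)
  coeff-map c (x ∷ xs) zero    = ≡.refl
  coeff-map c (x ∷ xs) (suc i) = coeff-map c xs i

  coeff-beyond : ∀ xs {i} → length xs ≤ i → coeff xs i ≡ + 0
  coeff-beyond []       _         = ≡.refl
  coeff-beyond (x ∷ xs) (s≤s len≤i) = coeff-beyond xs len≤i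

  coeff-*ₚ : ∀ x xs ys i → coeff ((x ∷ xs) *ₚ ys) i ≡ x * coeff ys i + coeff (+ 0 ∷ (xs *ₚ ys)) i
  coeff-*ₚ x xs ys i = ≡.trans (coeff-+ₚ (map (x *_) ys) (+ 0 ∷ (xs *ₚ ys)) i)
                               (≡.cong (_+ coeff (+ 0 ∷ (xs *ₚ ys)) i) (coeff-map x ys i))

  top-coefficient : ∀ gs k j → (∀ i → j < i → coeff k i ≈ₙ + 0) →
                    coeff ((gs ++ + 1 ∷ []) *ₚ k) (length gs ℕ.+ j) ≈ₙ coeff k j
  top-coefficient [] k j _ = ≡⇒≈ₙ (≡.trans (coeff-*ₚ (+ 1) [] k j)
    (≡.trans (≡.cong (λ z → + 1 * coeff k j + z) (coeff-[0] j))
             (≡.trans (ℤ.+-identityʳ _) (ℤ.*-identityˡ _))))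
    where
    coeff-[0] : ∀ i → coeff (+ 0 ∷ []) i ≡ + 0
    coeff-[0] zero    = ≡.refl
    coeff-[0] (suc i) = ≡.refl
  top-coefficient (g ∷ gs) k j k>j≈0 = begin
    coeff ((g ∷ gs ++ + 1 ∷ []) *ₚ k) (suc (length gs ℕ.+ j))
      ≡⟨ coeff-*ₚ g (gs ++ + 1 ∷ []) k (suc (length gs ℕ.+ j)) ⟩
    g * coeff k (suc (length gs ℕ.+ j)) + coeff ((gs ++ + 1 ∷ []) *ₚ k) (length gs ℕ.+ j)
      ≈⟨ +-cong-≈ₙ (*-cong-≈ₙ (≈ₙ-refl {g}) (k>j≈0 _ (s≤s (ℕ.m≤n+m j (length gs)))))
                   (top-coefficient gs k j k>j≈0) ⟩
    g * + 0 + coeff k j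
      ≡⟨ ≡.trans (≡.cong (_+ coeff k j) (ℤ.*-zeroʳ g)) (ℤ.+-identityˡ _) ⟩
    coeff k j ∎

  monic-not-unit : ∀ g gs → ¬ IsUnitₚ p (g ∷ gs ++ + 1 ∷ [])
  monic-not-unit g gs (k , gk≈1) = 1≉0 (begin
    + 1                         ≈⟨ mod (gk≈1 0) ⟨
    coeff (G *ₚ k) 0            ≡⟨ coeff-*ₚ g (gs ++ + 1 ∷ []) k 0 ⟩
    g * coeff k 0 + + 0         ≈⟨ +-cong-≈ₙ (*-cong-≈ₙ (≈ₙ-refl {g}) k₀≈0) (≈ₙ-refl {+ 0}) ⟩
    g * + 0 + + 0               ≡⟨ ≡.cong (_+ + 0) (ℤ.*-zeroʳ g) ⟩
    + 0                         ∎)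
    where
    G = g ∷ gs ++ + 1 ∷ []
    -- Downward induction: once the coefficients of k above j vanish, kⱼ is a coefficient of G k.
    vanishing : ∀ d j → length k ≤ d ℕ.+ j → ∀ i → j ≤ i → coeff k i ≈ₙ + 0
    vanishing zero    j |k|≤j i j≤i = ≡⇒≈ₙ (coeff-beyond k (ℕ.≤-trans |k|≤j j≤i))
    vanishing (suc d) j |k|≤ i j≤i = [ above-j i , at-j ]′ (ℕ.m≤n⇒m<n∨m≡n j≤i)
      where
      above-j : ∀ i → j < i → coeff k i ≈ₙ + 0
      above-j = vanishing d (suc j) (≡.subst (length k ≤_) (≡.sym (ℕ.+-suc d j)) |k|≤)
      at-j : j ≡ i → coeff k i ≈ₙ + 0
      at-j ≡.refl =
        ≈ₙ-trans (≈ₙ-sym (top-coefficient (g ∷ gs) k j above-j)) (mod (gk≈1 (suc (length gs ℕ.+ j))))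
    k₀≈0 : coeff k 0 ≈ₙ + 0
    k₀≈0 = vanishing (length k) 0 (ℕ.≤-reflexive (≡.sym (ℕ.+-identityʳ _))) 0 ℕ.z≤n

  irreducible⇒no-root : ∀ {a b} → IrreducibleModₚ p (b ∷ a ∷ + 0 ∷ + 1 ∷ []) → NoRootOfCubic a b
  irreducible⇒no-root {a} {b} (_ , _ , factors) s f[s]≈0 =
    [ monic-not-unit (- s) [] , monic-not-unit (s * s + a) (s ∷ []) ]′
      (factors (- s ∷ + 1 ∷ []) (s * s + a ∷ s ∷ + 1 ∷ []) (unmod ∘ f≈[X-s]q))
    where
    split₀ : ∀ a b s → b ≡ (s * s * s + a * s + b) + (- s * (s * s + a) + + 0)
    split₀ = solve-∀
    split₁ : ∀ a s → a ≡ - s * s + (+ 1 * (s * s + a) + + 0)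
    split₁ = solve-∀
    split₂ : ∀ s → + 0 ≡ - s * + 1 + + 1 * s
    split₂ = solve-∀
    f≈[X-s]q : ∀ i → coeff (b ∷ a ∷ + 0 ∷ + 1 ∷ []) i
                  ≈ₙ coeff ((- s ∷ + 1 ∷ []) *ₚ (s * s + a ∷ s ∷ + 1 ∷ [])) i
    f≈[X-s]q zero = ≈ₙ-trans (≡⇒≈ₙ (split₀ a b s))
      (≈ₙ-trans (+-cong-≈ₙ f[s]≈0 (≈ₙ-refl { - s * (s * s + a) + + 0})) (≡⇒≈ₙ (ℤ.+-identityˡ _)))
    f≈[X-s]q (suc zero)                   = ≡⇒≈ₙ (split₁ a s)
    f≈[X-s]q (suc (suc zero))             = ≡⇒≈ₙ (split₂ s)
    f≈[X-s]q (suc (suc (suc zero)))       = ≈ₙ-refl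
    f≈[X-s]q (suc (suc (suc (suc i))))    = ≈ₙ-refl

-- The ring 𝔽ₚ[α] with α³ + a α + b = 0

record Triple (A : Set) : Set where
  constructor ⟨_,_,_⟩
  field
    k₀ k₁ k₂ : A
open Triple

⟨⟩-cong : ∀ {A : Set} {x₀ x₁ x₂ y₀ y₁ y₂ : A} → x₀ ≡ y₀ → x₁ ≡ y₁ → x₂ ≡ y₂ →
          ⟨ x₀ , x₁ , x₂ ⟩ ≡ ⟨ y₀ , y₁ , y₂ ⟩
⟨⟩-cong ≡.refl ≡.refl ≡.refl = ≡.refl

-- Coordinates k₀ + k₁ α + k₂ α² in R[α], where α³ + a α + b = 0.
module CubicArithmetic {ℓ} (R : RawRing 0ℓ ℓ) (a b : RawRing.Carrier R) where
  open RawRing R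

  infixl 6 _⊕_
  infixl 7 _⊗_
  infix  8 ⊝_

  _⊕_ : Triple Carrier → Triple Carrier → Triple Carrier
  ⟨ x₀ , x₁ , x₂ ⟩ ⊕ ⟨ y₀ , y₁ , y₂ ⟩ = ⟨ x₀ + y₀ , x₁ + y₁ , x₂ + y₂ ⟩

  ⊝_ : Triple Carrier → Triple Carrier
  ⊝ ⟨ x₀ , x₁ , x₂ ⟩ = ⟨ - x₀ , - x₁ , - x₂ ⟩

  -- dᵢ is the coefficient of αⁱ in the product; then α³ = - a α - b and α⁴ = - a α² - b α.
  _⊗_ : Triple Carrier → Triple Carrier → Triple Carrier
  ⟨ x₀ , x₁ , x₂ ⟩ ⊗ ⟨ y₀ , y₁ , y₂ ⟩ =
    ⟨ d₀ + - (b * d₃) , d₁ + - (a * d₃) + - (b * d₄) , d₂ + - (a * d₄) ⟩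
    where
    d₀ = x₀ * y₀
    d₁ = x₀ * y₁ + x₁ * y₀
    d₂ = x₀ * y₂ + x₁ * y₁ + x₂ * y₀
    d₃ = x₁ * y₂ + x₂ * y₁
    d₄ = x₂ * y₂

  ι : Carrier → Triple Carrier
  ι c = ⟨ c , 0# , 0# ⟩

  α : Triple Carrier
  α = ⟨ 0# , 1# , 0# ⟩

module CubicArithmeticCong {ℓ} (R : CommutativeRing 0ℓ ℓ) (a b : CommutativeRing.Carrier R) where
  open CommutativeRing R
  open CubicArithmetic rawRing a b

  infix 4 _≋_
  record _≋_ (x y : Triple Carrier) : Set ℓ where
    constructor coordinatewise
    field
      ≈₀ : k₀ x ≈ k₀ y
      ≈₁ : k₁ x ≈ k₁ y
      ≈₂ : k₂ x ≈ k₂ y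

  ≋-isEquivalence : IsEquivalence _≋_
  ≋-isEquivalence = record
    { refl  = coordinatewise refl refl refl
    ; sym   = λ (coordinatewise e₀ e₁ e₂) → coordinatewise (sym e₀) (sym e₁) (sym e₂)
    ; trans = λ (coordinatewise e₀ e₁ e₂) (coordinatewise f₀ f₁ f₂) →
                coordinatewise (trans e₀ f₀) (trans e₁ f₁) (trans e₂ f₂) }

  ⊕-cong : ∀ {x y u v} → x ≋ y → u ≋ v → x ⊕ u ≋ y ⊕ v
  ⊕-cong (coordinatewise e₀ e₁ e₂) (coordinatewise f₀ f₁ f₂) =
    coordinatewise (+-cong e₀ f₀) (+-cong e₁ f₁) (+-cong e₂ f₂)

  ⊝-cong : ∀ {x y} → x ≋ y → ⊝ x ≋ ⊝ y
  ⊝-cong (coordinatewise e₀ e₁ e₂) = coordinatewise (-‿cong e₀) (-‿cong e₁) (-‿cong e₂)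

  ⊗-cong : ∀ {x y u v} → x ≋ y → u ≋ v → x ⊗ u ≋ y ⊗ v
  ⊗-cong (coordinatewise x₀ x₁ x₂) (coordinatewise y₀ y₁ y₂) = coordinatewise
    (+-cong d₀ (-‿cong (*-congˡ d₃)))
    (+-cong (+-cong d₁ (-‿cong (*-congˡ d₃))) (-‿cong (*-congˡ d₄)))
    (+-cong d₂ (-‿cong (*-congˡ d₄)))
    where
    d₀ = *-cong x₀ y₀
    d₁ = +-cong (*-cong x₀ y₁) (*-cong x₁ y₀)
    d₂ = +-cong (+-cong (*-cong x₀ y₂) (*-cong x₁ y₁)) (*-cong x₂ y₀)
    d₃ = +-cong (*-cong x₁ y₂) (*-cong x₂ y₁)
    d₄ = *-cong x₂ y₂

module ℤ[α] (a b : ℤ) where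
  open import Data.Fin using (#_)
  open import Data.Integer using (_*_; +-*-rawRing)
  open import Data.Integer.Solver using (module +-*-Solver)
  open +-*-Solver using (Polynomial; var; con; _:+_; _:*_; :-_; prove; ⟦_⟧; ⟦_⟧↓)
  open import Data.Vec using (Vec; _∷_; [])

  open CubicArithmetic +-*-rawRing a b public

  private
    symbolic : RawRing 0ℓ 0ℓ
    symbolic = record
      { Carrier = Polynomial 11 ; _≈_ = _≡_ ; _+_ = _:+_ ; _*_ = _:*_ ; -_ = :-_
      ; 0# = con (+ 0) ; 1# = con (+ 1) }

    module S = CubicArithmetic symbolic (var (# 0)) (var (# 1))

    x̂ ŷ ẑ : Triple (Polynomial 11)
    x̂ = ⟨ var (# 2) , var (# 3) , var (# 4) ⟩
    ŷ = ⟨ var (# 5) , var (# 6) , var (# 7) ⟩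
    ẑ = ⟨ var (# 8) , var (# 9) , var (# 10) ⟩

    env : Triple ℤ → Triple ℤ → Triple ℤ → Vec ℤ 11
    env x y z = a ∷ b ∷ k₀ x ∷ k₁ x ∷ k₂ x ∷ k₀ y ∷ k₁ y ∷ k₂ y ∷ k₀ z ∷ k₁ z ∷ k₂ z ∷ []

    ⟦_⟧ᵗ ⟦_⟧↓ᵗ : Triple (Polynomial 11) → Vec ℤ 11 → Triple ℤ
    ⟦ L ⟧ᵗ  ρ = ⟨ ⟦ k₀ L ⟧  ρ , ⟦ k₁ L ⟧  ρ , ⟦ k₂ L ⟧  ρ ⟩
    ⟦ L ⟧↓ᵗ ρ = ⟨ ⟦ k₀ L ⟧↓ ρ , ⟦ k₁ L ⟧↓ ρ , ⟦ k₂ L ⟧↓ ρ ⟩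

    -- An identity of triples is checked coordinatewise by the ring solver: in env x y z the
    -- symbolic triples x̂, ŷ, ẑ evaluate to x, y, z, and the operations of S to those of ℤ[α].
    solve-coordinates : ∀ x y z L R → ⟦ L ⟧↓ᵗ (env x y z) ≡ ⟦ R ⟧↓ᵗ (env x y z) →
                        ⟦ L ⟧ᵗ (env x y z) ≡ ⟦ R ⟧ᵗ (env x y z)
    solve-coordinates x y z L R eq = ⟨⟩-cong
      (prove ρ (k₀ L) (k₀ R) (≡.cong k₀ eq))
      (prove ρ (k₁ L) (k₁ R) (≡.cong k₁ eq))
      (prove ρ (k₂ L) (k₂ R) (≡.cong k₂ eq))
      where ρ = env x y z

  commutativeRing : CommutativeRing 0ℓ 0ℓ
  commutativeRing = record
    { Carrier = Triple ℤ ; _≈_ = _≡_ ; _+_ = _⊕_ ; _*_ = _⊗_ ; -_ = ⊝_ ; 0# = ι (+ 0) ; 1# = ι (+ 1)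
    ; isCommutativeRing = record
      { isRing = record
        { +-isAbelianGroup = record
          { isGroup = record
            { isMonoid = record
              { isSemigroup = record
                { isMagma = record { isEquivalence = ≡.isEquivalence ; ∙-cong = ≡.cong₂ _⊕_ }
                ; assoc = λ x y z → solve-coordinates x y z (x̂ S.⊕ ŷ S.⊕ ẑ) (x̂ S.⊕ (ŷ S.⊕ ẑ)) ≡.refl }
              ; identity = (λ x → solve-coordinates x x x (S.ι (con (+ 0)) S.⊕ x̂) x̂ ≡.refl)
                         , (λ x → solve-coordinates x x x (x̂ S.⊕ S.ι (con (+ 0))) x̂ ≡.refl) }
            ; inverse = (λ x → solve-coordinates x x x (S.⊝ x̂ S.⊕ x̂) (S.ι (con (+ 0))) ≡.refl)
                      , (λ x → solve-coordinates x x x (x̂ S.⊕ S.⊝ x̂) (S.ι (con (+ 0))) ≡.refl)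
            ; ⁻¹-cong = ≡.cong ⊝_ }
          ; comm = λ x y → solve-coordinates x y y (x̂ S.⊕ ŷ) (ŷ S.⊕ x̂) ≡.refl }
        ; *-cong = ≡.cong₂ _⊗_
        ; *-assoc = λ x y z → solve-coordinates x y z (x̂ S.⊗ ŷ S.⊗ ẑ) (x̂ S.⊗ (ŷ S.⊗ ẑ)) ≡.refl
        ; *-identity = (λ x → solve-coordinates x x x (S.ι (con (+ 1)) S.⊗ x̂) x̂ ≡.refl)
                     , (λ x → solve-coordinates x x x (x̂ S.⊗ S.ι (con (+ 1))) x̂ ≡.refl)
        ; distrib = (λ x y z → solve-coordinates x y z (x̂ S.⊗ (ŷ S.⊕ ẑ)) (x̂ S.⊗ ŷ S.⊕ x̂ S.⊗ ẑ) ≡.refl)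
                  , (λ x y z → solve-coordinates x y z ((ŷ S.⊕ ẑ) S.⊗ x̂) (ŷ S.⊗ x̂ S.⊕ ẑ S.⊗ x̂) ≡.refl) }
      ; *-comm = λ x y → solve-coordinates x y y (x̂ S.⊗ ŷ) (ŷ S.⊗ x̂) ≡.refl } }

  ι-* : ∀ x y → ι (x * y) ≡ ι x ⊗ ι y
  ι-* x y = solve-coordinates (ι x) (ι y) (ι y)
    (S.ι (var (# 2) :* var (# 5))) (S.ι (var (# 2)) S.⊗ S.ι (var (# 5))) ≡.refl

  α-root : α ⊗ α ⊗ α ⊕ ι a ⊗ α ⊕ ι b ≡ ι (+ 0)
  α-root = solve-coordinates α α α
    (S.α S.⊗ S.α S.⊗ S.α S.⊕ S.ι (var (# 0)) S.⊗ S.α S.⊕ S.ι (var (# 1))) (S.ι (con (+ 0))) ≡.refl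

  coordinates : ∀ x → x ≡ ι (k₀ x) ⊕ ι (k₁ x) ⊗ α ⊕ ι (k₂ x) ⊗ (α ⊗ α)
  coordinates x = solve-coordinates x x x
    x̂ (S.ι (var (# 2)) S.⊕ S.ι (var (# 3)) S.⊗ S.α S.⊕ S.ι (var (# 4)) S.⊗ (S.α S.⊗ S.α)) ≡.refl

module Cubic (p : ℕ) (p-prime : Prime p) (a b : ℤ) where
  import Algebra.Solver.Ring as RingSolver
  import Algebra.Solver.Ring.AlmostCommutativeRing as ACR
  import Data.Integer as ℤ
  import Data.Integer.Properties as ℤ
  open import Data.Integer.Tactic.RingSolver using (solve-∀)
  import Data.Maybe as Maybe
  open import Data.Nat.Divisibility using (∣-refl)
  open import Relation.Nullary using (yes; no)
  open import Relation.Nullary.Decidable using (dec⇒maybe)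

  open PrimeModulus p p-prime
  import Algebra.Properties.Semiring.Exp (CommutativeRing.semiring ℤ/nℤ) as ℤₚ
  open CubicArithmeticCong ℤ/nℤ a b using (_≋_; coordinatewise; ≋-isEquivalence; ⊕-cong; ⊗-cong; ⊝-cong)
  private module ℤα = ℤ[α] a b

  -- Opaque, so that ring expressions over 𝔽ₚ[α] are unified as written instead of being
  -- unfolded to integer coordinates.
  opaque
    𝔽ₚ[α] : CommutativeRing 0ℓ 0ℓ
    𝔽ₚ[α] = quotientRing {R = ℤα.commutativeRing} (record
      { _∼_ = _≋_ ; isEquivalence = ≋-isEquivalence
      ; ≈⇒∼ = λ { ≡.refl → coordinatewise ≈ₙ-refl ≈ₙ-refl ≈ₙ-refl }
      ; +-cong = ⊕-cong ; *-cong = ⊗-cong ; -‿cong = ⊝-cong })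

  open CommutativeRing 𝔽ₚ[α] public
  open import Algebra.Properties.Ring ring using (-‿involutive; -0#≈0#)
  open import Algebra.Properties.Group +-group using (x∙y⁻¹≈ε⇒x≈y)
  import Data.Nat as ℕ
  import Data.Nat.Properties as ℕ
  open import Data.Empty using (⊥)
  open import Data.List using (List; []; _∷_; length; applyUpTo)
  open import Data.List.Properties using (length-applyUpTo)
  open import Data.List.Relation.Unary.All using (All; []; _∷_)
  import Data.List.Relation.Unary.All.Properties as All
  open import Data.List.Relation.Unary.AllPairs using (AllPairs; []; _∷_)
  import Data.List.Relation.Unary.AllPairs.Properties as AllPairs
  open import Relation.Nullary using (Dec; ¬_)
  open import Relation.Nullary.Decidable as Dec using (_×-dec_)

  opaque
    unfolding 𝔽ₚ[α]

    ι : ℤ → Carrier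
    ι = ℤα.ι

    α : Carrier
    α = ℤα.α

    ι-cong : ∀ {x y} → x ≈ₙ y → ι x ≈ ι y
    ι-cong x≈y = coordinatewise x≈y ≈ₙ-refl ≈ₙ-refl

    ι-injective : ∀ {x y} → ι x ≈ ι y → x ≈ₙ y
    ι-injective (coordinatewise x≈y _ _) = x≈y

    ι-+ : ∀ x y → ι (x ℤ.+ y) ≈ ι x + ι y
    ι-+ x y = refl

    ι-* : ∀ x y → ι (x ℤ.* y) ≈ ι x * ι y
    ι-* x y = reflexive (ℤα.ι-* x y)

    ι-‿ : ∀ x → ι (ℤ.- x) ≈ - ι x
    ι-‿ x = refl

    ι-0 : ι (+ 0) ≈ 0#
    ι-0 = refl

    ι-1 : ι (+ 1) ≈ 1#
    ι-1 = refl

    α≉ι : ∀ c → α ≉ ι c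
    α≉ι c (coordinatewise _ 1≈0 _) = 1≉0 1≈0

    cubic-α : α * α * α + ι a * α + ι b ≈ 0#
    cubic-α = reflexive ℤα.α-root

    coordinates : ∀ x → ∃[ x₀ ] ∃[ x₁ ] ∃[ x₂ ] x ≈ ι x₀ + ι x₁ * α + ι x₂ * (α * α)
    coordinates x = k₀ x , k₁ x , k₂ x , reflexive (ℤα.coordinates x)

    infix 4 _≈?_
    _≈?_ : ∀ x y → Dec (x ≈ y)
    x ≈? y = Dec.map′ (λ (e₀ , e₁ , e₂) → coordinatewise e₀ e₁ e₂)
                      (λ (coordinatewise e₀ e₁ e₂) → e₀ , e₁ , e₂)
      ((k₀ x ≈ₙ? k₀ y) ×-dec (k₁ x ≈ₙ? k₁ y) ×-dec (k₂ x ≈ₙ? k₂ y))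

  private
    ι-homomorphism : ℤ.+-*-rawRing ACR.-Raw-AlmostCommutative⟶ ACR.fromCommutativeRing 𝔽ₚ[α]
    ι-homomorphism = record
      { ⟦_⟧ = ι ; +-homo = ι-+ ; *-homo = ι-* ; -‿homo = ι-‿ ; 0-homo = ι-0 ; 1-homo = ι-1 }

    ι-≟ : ∀ x y → Maybe.Maybe (ι x ≈ ι y)
    ι-≟ x y = Maybe.map (ι-cong ∘ ≡⇒≈ₙ) (dec⇒maybe (x ℤ.≟ y))

  module Solver = RingSolver ℤ.+-*-rawRing (ACR.fromCommutativeRing 𝔽ₚ[α]) ι-homomorphism ι-≟

  open Solver using (solve; _:=_; _:+_; _:*_; _:-_; :-_; con)
  open import Algebra.Properties.Semiring.Exp semiring using (_^_; ^-congˡ)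
  open import Algebra.Properties.CommutativeSemiring.Exp commutativeSemiring using (^-distrib-*)
  open Mult semiring using (_×_)
  open import Relation.Binary.Reasoning.Setoid setoid
  import Data.Product as Product

  cubic : Carrier → Carrier
  cubic y = y * y * y + ι a * y + ι b

  cubic-cong : ∀ {x y} → x ≈ y → cubic x ≈ cubic y
  cubic-cong x≈y = +-congʳ (+-cong (*-cong (*-cong x≈y x≈y) x≈y) (*-congˡ x≈y))

  ι-cubic : ∀ s → ι (s ℤ.* s ℤ.* s ℤ.+ a ℤ.* s ℤ.+ b) ≈ cubic (ι s)
  ι-cubic s = begin
    ι (s ℤ.* s ℤ.* s ℤ.+ a ℤ.* s ℤ.+ b)    ≈⟨ trans (ι-+ _ b) (+-congʳ (ι-+ _ _)) ⟩
    ι (s ℤ.* s ℤ.* s) + ι (a ℤ.* s) + ι b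
      ≈⟨ +-congʳ (+-cong (trans (ι-* (s ℤ.* s) s) (*-congʳ (ι-* s s))) (ι-* a s)) ⟩
    cubic (ι s)                            ∎

  ι-^ : ∀ c n → ι c ^ n ≈ ι (c ℤₚ.^ n)
  ι-^ c zero    = sym ι-1
  ι-^ c (suc n) = trans (*-congˡ (ι-^ c n)) (sym (ι-* c (c ℤₚ.^ n)))

  ×1#≈ι : ∀ m → m × 1# ≈ ι (+ m)
  ×1#≈ι zero    = sym ι-0
  ×1#≈ι (suc m) = trans (+-cong (sym ι-1) (×1#≈ι m)) (sym (ι-+ (+ 1) (+ m)))

  p×1#≈0# : p × 1# ≈ 0#
  p×1#≈0# = trans (×1#≈ι p) (trans (ι-cong (p∣⇒≈0 ∣-refl)) ι-0)

  open Frobenius 𝔽ₚ[α] p-prime p×1#≈0# using (^p-distrib-+; ^p-distrib-‿)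

  φ : Carrier → Carrier
  φ y = y ^ p

  φ-cong : ∀ {x y} → x ≈ y → φ x ≈ φ y
  φ-cong = ^-congˡ p

  φ-+ : ∀ x y → φ (x + y) ≈ φ x + φ y
  φ-+ = ^p-distrib-+

  φ-* : ∀ x y → φ (x * y) ≈ φ x * φ y
  φ-* x y = ^-distrib-* x y p

  φ-‿ : ∀ x → φ (- x) ≈ - φ x
  φ-‿ = ^p-distrib-‿

  φ-ι : ∀ c → φ (ι c) ≈ ι c
  φ-ι c = trans (ι-^ c p) (ι-cong (fermat c))

  φ-cubic : ∀ y → φ (cubic y) ≈ cubic (φ y)
  φ-cubic y = trans (φ-+ _ _) (+-cong (trans (φ-+ _ _) (+-cong
    (trans (φ-* (y * y) y) (*-congʳ (φ-* y y)))
    (trans (φ-* (ι a) y) (*-congʳ (φ-ι a))))) (φ-ι b))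

  φ-0 : φ 0# ≈ 0#
  φ-0 = trans (φ-cong (sym ι-0)) (trans (φ-ι (+ 0)) ι-0)

  x-y≈0⇒x≈y : ∀ {x y} → x - y ≈ 0# → x ≈ y
  x-y≈0⇒x≈y = x∙y⁻¹≈ε⇒x≈y _ _

  x*z≈0⇒y*x*z≈0 : ∀ {x z} y → x * z ≈ 0# → y * x * z ≈ 0#
  x*z≈0⇒y*x*z≈0 {x} {z} y x*z≈0 = begin
    y * x * z    ≈⟨ *-assoc y x z ⟩
    y * (x * z)  ≈⟨ *-congˡ x*z≈0 ⟩
    y * 0#       ≈⟨ zeroʳ y ⟩
    0#           ∎

  remainder-annihilated : ∀ {F P m R z} → F ≈ P * m + R → F ≈ 0# → m * z ≈ 0# → R * z ≈ 0#
  remainder-annihilated {F} {P} {m} {R} {z} F≈Pm+R F≈0 m*z≈0 = begin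
    R * z
      ≈⟨ solve 4 (λ P m R z → R :* z := (P :* m :+ R) :* z :- P :* (m :* z)) refl P m R z ⟩
    (P * m + R) * z - P * (m * z)
      ≈⟨ +-cong (*-congʳ (trans (sym F≈Pm+R) F≈0)) (-‿cong (*-congˡ m*z≈0)) ⟩
    0# * z - P * 0#                 ≈⟨ trans (+-cong (zeroˡ z) (-‿cong (zeroʳ P))) (-‿inverseʳ 0#) ⟩
    0#                              ∎

  1#≉0# : 1# ≉ 0#
  1#≉0# 1≈0 = 1≉0 (ι-injective (trans ι-1 (trans 1≈0 (sym ι-0))))

  ι-invertible : ∀ {c} → ¬ c ≈ₙ + 0 → ∃[ d ] ι d * ι c ≈ 1#
  ι-invertible {c} c≉0 = d , trans (sym (ι-* d c))
    (trans (ι-cong (≈ₙ-trans (≡⇒≈ₙ (ℤ.*-comm d c)) (proj₂ (inverse c≉0)))) ι-1)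
    where d = proj₁ (inverse c≉0)

  module Cancellation (no-root : NoRootOfCubic a b) where

    no-ι-root : ∀ s → cubic (ι s) ≉ 0#
    no-ι-root s cubic[ι[s]]≈0 = no-root s (ι-injective (trans (ι-cubic s) (trans cubic[ι[s]]≈0 (sym ι-0))))

    ι-cancel : ∀ {c z} → ¬ c ≈ₙ + 0 → ι c * z ≈ 0# → z ≈ 0#
    ι-cancel {c} {z} c≉0 c*z≈0 = begin
      z                ≈⟨ *-identityˡ z ⟨
      1# * z           ≈⟨ *-congʳ (proj₂ (ι-invertible c≉0)) ⟨
      ι d * ι c * z    ≈⟨ x*z≈0⇒y*x*z≈0 (ι d) c*z≈0 ⟩
      0#               ∎
      where d = proj₁ (ι-invertible c≉0)

    α-ι-cancel : ∀ {s z} → (α - ι s) * z ≈ 0# → z ≈ 0#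
    α-ι-cancel {s} {z} [α-ι[s]]*z≈0 =
      ι-cancel (no-root s) (trans (*-congʳ (ι-cubic s)) (remainder-annihilated division cubic-α [α-ι[s]]*z≈0))
      where
      division : cubic α ≈ (α * α + ι s * α + ι s * ι s + ι a) * (α - ι s) + cubic (ι s)
      division = solve 4 (λ x s A B →
        x :* x :* x :+ A :* x :+ B := (x :* x :+ s :* x :+ s :* s :+ A) :* (x :- s) :+ (s :* s :* s :+ A :* s :+ B))
        refl α (ι s) (ι a) (ι b)

    linear-cancel : ∀ {k e z} → ¬ (k ≈ₙ + 0 Product.× e ≈ₙ + 0) → (ι k * α + ι e) * z ≈ 0# → z ≈ 0#
    linear-cancel {k} {e} {z} k,e≉0 [kα+e]*z≈0 = by-cases (k ≈ₙ? + 0)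
      where
      by-cases : Dec (k ≈ₙ + 0) → z ≈ 0#
      by-cases (yes k≈0) = ι-cancel (λ e≈0 → k,e≉0 (k≈0 , e≈0)) (begin
        ι e * z                  ≈⟨ *-congʳ (solve 2 (λ x E → E := con (+ 0) :* x :+ E) refl α (ι e)) ⟩
        (ι (+ 0) * α + ι e) * z  ≈⟨ *-congʳ (+-congʳ (*-congʳ (ι-cong (≈ₙ-sym k≈0)))) ⟩
        (ι k * α + ι e) * z      ≈⟨ [kα+e]*z≈0 ⟩
        0#                       ∎)
      by-cases (no k≉0) = α-ι-cancel (begin
        (α - ι (ℤ.- (d ℤ.* e))) * z     ≈⟨ *-congʳ monic ⟨
        ι d * (ι k * α + ι e) * z        ≈⟨ x*z≈0⇒y*x*z≈0 (ι d) [kα+e]*z≈0 ⟩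
        0#                               ∎)
        where
        d = proj₁ (ι-invertible k≉0)
        monic : ι d * (ι k * α + ι e) ≈ α - ι (ℤ.- (d ℤ.* e))
        monic = begin
          ι d * (ι k * α + ι e)
            ≈⟨ solve 4 (λ D K x E → D :* (K :* x :+ E) := D :* K :* x :+ D :* E) refl (ι d) (ι k) α (ι e) ⟩
          ι d * ι k * α + ι d * ι e
            ≈⟨ +-cong (trans (*-congʳ (proj₂ (ι-invertible k≉0))) (*-identityˡ α)) (sym (ι-* d e)) ⟩
          α + ι (d ℤ.* e)
            ≈⟨ +-congˡ (trans (sym (-‿involutive _)) (-‿cong (sym (ι-‿ (d ℤ.* e))))) ⟩
          α - ι (ℤ.- (d ℤ.* e))          ∎

    monic-quadratic-cancel : ∀ {μ ν z} → (α * α + ι μ * α + ι ν) * z ≈ 0# → z ≈ 0#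
    monic-quadratic-cancel {μ} {ν} {z} m*z≈0 =
      linear-cancel remainder≉0 (remainder-annihilated division cubic-α m*z≈0)
      where
      r₁ = a ℤ.- ν ℤ.+ μ ℤ.* μ
      r₀ = b ℤ.+ μ ℤ.* ν
      ι-r₁ : ι a - ι ν + ι μ * ι μ ≈ ι r₁
      ι-r₁ = sym (trans (ι-+ _ _) (+-cong (trans (ι-+ a (ℤ.- ν)) (+-congˡ (ι-‿ ν))) (ι-* μ μ)))
      ι-r₀ : ι b + ι μ * ι ν ≈ ι r₀
      ι-r₀ = sym (trans (ι-+ b _) (+-congˡ (ι-* μ ν)))
      division : cubic α ≈ (α - ι μ) * (α * α + ι μ * α + ι ν) + (ι r₁ * α + ι r₀)
      division = trans
        (solve 5 (λ x M N A B → x :* x :* x :+ A :* x :+ B :=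
                   (x :- M) :* (x :* x :+ M :* x :+ N) :+ ((A :- N :+ M :* M) :* x :+ (B :+ M :* N)))
                 refl α (ι μ) (ι ν) (ι a) (ι b))
        (+-congˡ (+-cong (*-congʳ ι-r₁) ι-r₀))
      cubic≡remainder : ∀ a b μ ν →
        μ ℤ.* μ ℤ.* μ ℤ.+ a ℤ.* μ ℤ.+ b ≡ (a ℤ.- ν ℤ.+ μ ℤ.* μ) ℤ.* μ ℤ.+ (b ℤ.+ μ ℤ.* ν)
      cubic≡remainder = solve-∀
      remainder≉0 : ¬ (r₁ ≈ₙ + 0 Product.× r₀ ≈ₙ + 0)
      remainder≉0 (r₁≈0 , r₀≈0) =
        no-root μ (≈ₙ-trans (≡⇒≈ₙ (cubic≡remainder a b μ ν)) (+-cong-≈ₙ (*-cong-≈ₙ r₁≈0 ≈ₙ-refl) r₀≈0))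

    cancel : NoZeroDivisors 𝔽ₚ[α]
    cancel {x} {z} x≉0 x*z≈0 = by-coordinates (coordinates x)
      where
      by-coordinates : (∃[ x₀ ] ∃[ x₁ ] ∃[ x₂ ] x ≈ ι x₀ + ι x₁ * α + ι x₂ * (α * α)) → z ≈ 0#
      by-coordinates (x₀ , x₁ , x₂ , x≈) = by-cases (x₂ ≈ₙ? + 0)
        where
        by-cases : Dec (x₂ ≈ₙ + 0) → z ≈ 0#
        by-cases (yes x₂≈0) = linear-cancel x₁,x₀≉0 (trans (*-congʳ (sym x≈x₁α+x₀)) x*z≈0)
          where
          ι≈0 : ∀ {c} → c ≈ₙ + 0 → ι c ≈ 0#
          ι≈0 c≈0 = trans (ι-cong c≈0) ι-0
          x≈x₁α+x₀ : x ≈ ι x₁ * α + ι x₀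
          x≈x₁α+x₀ = begin
            x                                  ≈⟨ x≈ ⟩
            ι x₀ + ι x₁ * α + ι x₂ * (α * α)   ≈⟨ +-congˡ (trans (*-congʳ (ι≈0 x₂≈0)) (zeroˡ _)) ⟩
            ι x₀ + ι x₁ * α + 0#               ≈⟨ +-identityʳ _ ⟩
            ι x₀ + ι x₁ * α                    ≈⟨ +-comm _ _ ⟩
            ι x₁ * α + ι x₀                    ∎
          x₁,x₀≉0 : ¬ (x₁ ≈ₙ + 0 Product.× x₀ ≈ₙ + 0)
          x₁,x₀≉0 (x₁≈0 , x₀≈0) = x≉0 (begin
            x                ≈⟨ x≈x₁α+x₀ ⟩
            ι x₁ * α + ι x₀  ≈⟨ +-cong (trans (*-congʳ (ι≈0 x₁≈0)) (zeroˡ α)) (ι≈0 x₀≈0) ⟩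
            0# + 0#          ≈⟨ +-identityʳ 0# ⟩
            0#               ∎)
        by-cases (no x₂≉0) = monic-quadratic-cancel (begin
          (α * α + ι μ * α + ι ν) * z  ≈⟨ *-congʳ monic ⟨
          ι d * x * z                  ≈⟨ x*z≈0⇒y*x*z≈0 (ι d) x*z≈0 ⟩
          0#                           ∎)
          where
          d = proj₁ (ι-invertible x₂≉0)
          μ = d ℤ.* x₁
          ν = d ℤ.* x₀
          monic : ι d * x ≈ α * α + ι μ * α + ι ν
          monic = begin
            ι d * x                                              ≈⟨ *-congˡ x≈ ⟩
            ι d * (ι x₀ + ι x₁ * α + ι x₂ * (α * α))             ≈⟨ solve 5 (λ D X₀ X₁ X₂ x →
                D :* (X₀ :+ X₁ :* x :+ X₂ :* (x :* x)) := D :* X₂ :* (x :* x) :+ D :* X₁ :* x :+ D :* X₀)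
                refl (ι d) (ι x₀) (ι x₁) (ι x₂) α ⟩
            ι d * ι x₂ * (α * α) + ι d * ι x₁ * α + ι d * ι x₀  ≈⟨ +-cong (+-cong
                (trans (*-congʳ (proj₂ (ι-invertible x₂≉0))) (*-identityˡ _))
                (*-congʳ (sym (ι-* d x₁)))) (sym (ι-* d x₀)) ⟩
            α * α + ι μ * α + ι ν                                ∎

    open RootBound 𝔽ₚ[α] cancel using (eval; root-bound)

    -- Otherwise 0, 1, …, p - 1 and α would be p + 1 distinct roots of Xᵖ - X.
    α-not-fixed : φ α ≉ α
    α-not-fixed φ[α]≈α = fixed-points-bounded (p ℕ.∸ 2) (≡.sym (ℕ.m+[n∸m]≡n (ℕ.nonTrivial⇒n>1 p)))
      where
      monomial : ℕ → List Carrier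
      monomial zero    = 1# ∷ []
      monomial (suc n) = 0# ∷ monomial n

      length-monomial : ∀ n → length (monomial n) ≡ suc n
      length-monomial zero    = ≡.refl
      length-monomial (suc n) = ≡.cong suc (length-monomial n)

      eval-monomial : ∀ n y → eval (monomial n) y ≈ y ^ n
      eval-monomial zero    y = trans (+-congˡ (zeroʳ y)) (+-identityʳ 1#)
      eval-monomial (suc n) y = trans (+-identityˡ _) (*-congˡ (eval-monomial n y))

      fixed-points-bounded : ∀ k → p ≡ suc (suc k) → ⊥
      fixed-points-bounded k ≡.refl = -1#≉0 (root-bound Xᵖ-X roots distinct |Xᵖ-X|≤|roots| roots-vanish)
        where
        Xᵖ-X : List Carrier
        Xᵖ-X = 0# ∷ - 1# ∷ monomial k
        residues = applyUpTo (ι ∘ +_) p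
        roots = α ∷ residues
        eval-Xᵖ-X : ∀ y → eval Xᵖ-X y ≈ φ y - y
        eval-Xᵖ-X y = begin
          0# + y * (- 1# + y * eval (monomial k) y)  ≈⟨ +-identityˡ _ ⟩
          y * (- 1# + y * eval (monomial k) y)
            ≈⟨ *-congˡ (+-congˡ (*-congˡ (eval-monomial k y))) ⟩
          y * (- 1# + y * y ^ k)
            ≈⟨ solve 3 (λ y m o → y :* (:- o :+ y :* m) := y :* (y :* m) :- y :* o) refl y (y ^ k) 1# ⟩
          y * (y * y ^ k) - y * 1#                   ≈⟨ +-congˡ (-‿cong (*-identityʳ y)) ⟩
          φ y - y                                    ∎
        fixed-point-root : ∀ {y} → φ y ≈ y → eval Xᵖ-X y ≈ 0#
        fixed-point-root {y} φ[y]≈y = trans (eval-Xᵖ-X y) (trans (+-congʳ φ[y]≈y) (-‿inverseʳ y))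
        distinct : AllPairs _≉_ roots
        distinct = All.applyUpTo⁺₂ (ι ∘ +_) p (α≉ι ∘ +_)
                 ∷ AllPairs.applyUpTo⁺₁ (ι ∘ +_) p (λ i<j j<p ι[i]≈ι[j] →
                     distinct-residues i<j j<p (≈ₙ-sym (ι-injective ι[i]≈ι[j])))
        |Xᵖ-X|≤|roots| : length Xᵖ-X ℕ.≤ length roots
        |Xᵖ-X|≤|roots| = ℕ.≤-reflexive (≡.trans (≡.cong (suc ∘ suc) (length-monomial k))
                                                (≡.cong suc (≡.sym (length-applyUpTo (ι ∘ +_) p))))
        roots-vanish : All (λ r → eval Xᵖ-X r ≈ 0#) roots
        roots-vanish = fixed-point-root φ[α]≈α ∷ All.applyUpTo⁺₂ (ι ∘ +_) p (fixed-point-root ∘ φ-ι ∘ +_)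
        -1#≉0 : ¬ All (_≈ 0#) Xᵖ-X
        -1#≉0 (_ ∷ -1≈0 ∷ _) = 1#≉0# (trans (sym (-‿involutive 1#)) (trans (-‿cong -1≈0) -0#≈0#))

module Evaluation (p : ℕ) (p-prime : Prime p) (a b : ℤ) where
  open Cubic p p-prime a b
  open PrimeModulus p p-prime using (_≈ₙ_; mod)
  open Solver using (solve; _:=_; _:+_; _:*_; :-_; con)
  open import Algebra.Properties.Semiring.Exp semiring using (_^_)
  import Data.Integer as ℤ
  open import Data.List using ([]; _∷_; map)
  open import Defs using (Poly; coeff; _+ₚ_; -ₚ_; _-ₚ_; _*ₚ_; X^; _≡_[modₚ_,_])
  open import Relation.Binary.Reasoning.Setoid setoid

  -- The empty list is sent to ι (+ 0) rather than 0#, so that the solver sees a constant.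

  evalα : Poly → Carrier
  evalα []       = ι (+ 0)
  evalα (c ∷ cs) = ι c + α * evalα cs

  evalα-+ₚ : ∀ xs ys → evalα (xs +ₚ ys) ≈ evalα xs + evalα ys
  evalα-+ₚ []       ys       = solve 1 (λ y → y := con (+ 0) :+ y) refl (evalα ys)
  evalα-+ₚ (x ∷ xs) []       = solve 1 (λ y → y := y :+ con (+ 0)) refl (evalα (x ∷ xs))
  evalα-+ₚ (x ∷ xs) (y ∷ ys) = begin
    ι (x ℤ.+ y) + α * evalα (xs +ₚ ys)                ≈⟨ +-cong (ι-+ x y) (*-congˡ (evalα-+ₚ xs ys)) ⟩
    ι x + ι y + α * (evalα xs + evalα ys)
      ≈⟨ solve 5 (λ X Y A R S → X :+ Y :+ A :* (R :+ S) := X :+ A :* R :+ (Y :+ A :* S))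
                                                          refl (ι x) (ι y) α (evalα xs) (evalα ys) ⟩
    ι x + α * evalα xs + (ι y + α * evalα ys)         ∎

  evalα-map : ∀ c xs → evalα (map (c ℤ.*_) xs) ≈ ι c * evalα xs
  evalα-map c []       = solve 1 (λ C → con (+ 0) := C :* con (+ 0)) refl (ι c)
  evalα-map c (x ∷ xs) = begin
    ι (c ℤ.* x) + α * evalα (map (c ℤ.*_) xs)   ≈⟨ +-cong (ι-* c x) (*-congˡ (evalα-map c xs)) ⟩
    ι c * ι x + α * (ι c * evalα xs)
      ≈⟨ solve 4 (λ C X A R → C :* X :+ A :* (C :* R) := C :* (X :+ A :* R))
                                                    refl (ι c) (ι x) α (evalα xs) ⟩
    ι c * (ι x + α * evalα xs)                  ∎

  evalα-‿ : ∀ xs → evalα (-ₚ xs) ≈ - evalα xs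
  evalα-‿ []       = solve 0 (con (+ 0) := :- con (+ 0)) refl
  evalα-‿ (x ∷ xs) = begin
    ι (ℤ.- x) + α * evalα (-ₚ xs)    ≈⟨ +-cong (ι-‿ x) (*-congˡ (evalα-‿ xs)) ⟩
    - ι x + α * - evalα xs
      ≈⟨ solve 3 (λ X A R → :- X :+ A :* :- R := :- (X :+ A :* R)) refl (ι x) α (evalα xs) ⟩
    - (ι x + α * evalα xs)           ∎

  evalα-*ₚ : ∀ xs ys → evalα (xs *ₚ ys) ≈ evalα xs * evalα ys
  evalα-*ₚ []       ys = solve 1 (λ Y → con (+ 0) := con (+ 0) :* Y) refl (evalα ys)
  evalα-*ₚ (x ∷ xs) ys = begin
    evalα (map (x ℤ.*_) ys +ₚ (+ 0 ∷ (xs *ₚ ys)))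
      ≈⟨ evalα-+ₚ (map (x ℤ.*_) ys) (+ 0 ∷ (xs *ₚ ys)) ⟩
    evalα (map (x ℤ.*_) ys) + (ι (+ 0) + α * evalα (xs *ₚ ys))
      ≈⟨ +-cong (evalα-map x ys) (+-congˡ (*-congˡ (evalα-*ₚ xs ys))) ⟩
    ι x * evalα ys + (ι (+ 0) + α * (evalα xs * evalα ys))
      ≈⟨ solve 4 (λ X Y A R → X :* Y :+ (con (+ 0) :+ A :* (R :* Y)) := (X :+ A :* R) :* Y)
                                                               refl (ι x) (evalα ys) α (evalα xs) ⟩
    (ι x + α * evalα xs) * evalα ys                       ∎

  evalα-cong : ∀ xs ys → (∀ i → coeff xs i ≈ₙ coeff ys i) → evalα xs ≈ evalα ys
  evalα-cong []       []       _     = refl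
  evalα-cong []       (y ∷ ys) xs≈ys = trans (solve 1 (λ A → con (+ 0) := con (+ 0) :+ A :* con (+ 0)) refl α)
    (+-cong (ι-cong (xs≈ys 0)) (*-congˡ (evalα-cong [] ys (xs≈ys ∘ suc))))
  evalα-cong (x ∷ xs) []       xs≈ys =
    trans (+-cong (ι-cong (xs≈ys 0)) (*-congˡ (evalα-cong xs [] (xs≈ys ∘ suc))))
    (solve 1 (λ A → con (+ 0) :+ A :* con (+ 0) := con (+ 0)) refl α)
  evalα-cong (x ∷ xs) (y ∷ ys) xs≈ys = +-cong (ι-cong (xs≈ys 0)) (*-congˡ (evalα-cong xs ys (xs≈ys ∘ suc)))

  evalα-X^ : ∀ n → evalα (X^ n) ≈ α ^ n
  evalα-X^ zero    = trans (solve 1 (λ A → con (+ 1) :+ A :* con (+ 0) := con (+ 1)) refl α) ι-1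
  evalα-X^ (suc n) = trans (+-cong ι-0 (*-congˡ (evalα-X^ n))) (+-identityˡ _)

  frobenius-of-α : ∀ {c₀ c₁ c₂} → X^ p ≡ (c₀ ∷ c₁ ∷ c₂ ∷ []) [modₚ p , b ∷ a ∷ + 0 ∷ + 1 ∷ [] ] →
                   φ α ≈ ι c₂ * (α * α) + ι c₁ * α + ι c₀
  frobenius-of-α {c₀} {c₁} {c₂} (q , xᵖ-c≈qf) = begin
    φ α            ≈⟨ evalα-X^ p ⟨
    evalα (X^ p)   ≈⟨ x-y≈0⇒x≈y xᵖ-c≈0 ⟩
    evalα c
      ≈⟨ solve 4 (λ C₀ C₁ C₂ x →
                   C₀ :+ x :* (C₁ :+ x :* (C₂ :+ x :* con (+ 0))) := C₂ :* (x :* x) :+ C₁ :* x :+ C₀)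
                        refl (ι c₀) (ι c₁) (ι c₂) α ⟩
    ι c₂ * (α * α) + ι c₁ * α + ι c₀ ∎
    where
    c = c₀ ∷ c₁ ∷ c₂ ∷ []
    f = b ∷ a ∷ + 0 ∷ + 1 ∷ []
    evalα-f : evalα f ≈ cubic α
    evalα-f = solve 3 (λ A B x → B :+ x :* (A :+ x :* (con (+ 0) :+ x :* (con (+ 1) :+ x :* con (+ 0)))) :=
                                  x :* x :* x :+ A :* x :+ B) refl (ι a) (ι b) α
    xᵖ-c≈0 : evalα (X^ p) - evalα c ≈ 0#
    xᵖ-c≈0 = begin
      evalα (X^ p) - evalα c      ≈⟨ +-congˡ (evalα-‿ c) ⟨
      evalα (X^ p) + evalα (-ₚ c) ≈⟨ evalα-+ₚ (X^ p) (-ₚ c) ⟨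
      evalα (X^ p -ₚ c)           ≈⟨ evalα-cong (X^ p -ₚ c) (q *ₚ f) (mod ∘ xᵖ-c≈qf) ⟩
      evalα (q *ₚ f)              ≈⟨ evalα-*ₚ q f ⟩
      evalα q * evalα f           ≈⟨ *-congˡ (trans evalα-f cubic-α) ⟩
      evalα q * 0#                ≈⟨ zeroʳ _ ⟩
      0#                          ∎

-- The Frobenius orbit of α

module Orbit (p : ℕ) (p-prime : Prime p) (a b : ℤ) (no-root : Congruence.NoRootOfCubic p a b)
  (c₀ c₁ c₂ : ℤ) where
  open Cubic p p-prime a b
  open Cancellation no-root
  open PrimeModulus p p-prime using (_≈ₙ_; _≈ₙ?_; ≈ₙ-refl; ≈ₙ-sym; ≈ₙ-trans; ≡⇒≈ₙ; +-cong-≈ₙ; inverse)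
  open Solver using (solve; _:=_; _:+_; _:*_; _:-_; :-_; _:^_; con)
  open import Algebra.Properties.Group +-group using (inverseʳ-unique)
  open import Algebra.Properties.Ring ring using (-0#≈0#)
  open import Algebra.Properties.Semiring.Exp semiring using (_^_; ^-congˡ)
  import Data.Integer as ℤ
  open import Data.Integer.Tactic.RingSolver using (solve-∀)
  import Data.Product as Product
  open import Data.Sum using (_⊎_; inj₁; inj₂; [_,_]′)
  open import Relation.Binary.Reasoning.Setoid setoid
  open import Relation.Nullary using (¬_; Dec; yes; no; contradiction)

  u : Carrier → Carrier
  u y = ι c₂ * (y * y) + ι c₁ * y + ι c₀

  u-cong : ∀ {x y} → x ≈ y → u x ≈ u y
  u-cong x≈y = +-congʳ (+-cong (*-congˡ (*-cong x≈y x≈y)) (*-congˡ x≈y))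

  φ-u : ∀ y → φ (u y) ≈ u (φ y)
  φ-u y = trans (φ-+ _ _) (+-cong (trans (φ-+ _ _) (+-cong
    (trans (φ-* _ _) (*-cong (φ-ι c₂) (φ-* y y)))
    (trans (φ-* _ _) (*-congʳ (φ-ι c₁))))) (φ-ι c₀))

  u-difference : ∀ y z → u y - u z ≈ (y - z) * (ι c₂ * (y + z) + ι c₁)
  u-difference y z = solve 5 (λ y z C₂ C₁ C₀ →
    (C₂ :* (y :* y) :+ C₁ :* y :+ C₀) :- (C₂ :* (z :* z) :+ C₁ :* z :+ C₀) :=
    (y :- z) :* (C₂ :* (y :+ z) :+ C₁))
    refl y z (ι c₂) (ι c₁) (ι c₀)

  -- The determinant with rows (1, v, u v), v = x, y, z, is c₂ times the Vandermonde determinant,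
  -- as u v - c₂ v² is a combination of 1 and v; the right-hand side evaluates it using the cycle.
  cyclic-interpolation : ∀ {x y z} → u x ≈ y → u y ≈ z → u z ≈ x →
    ι c₂ * ((x - y) * (y - z) * (z - x)) ≈ y * x - z * z - (x * x - z * y) + (x * z - y * y)
  cyclic-interpolation {x} {y} {z} u[x]≈y u[y]≈z u[z]≈x = begin
    ι c₂ * ((x - y) * (y - z) * (z - x))
      ≈⟨ solve 6 (λ x y z C₂ C₁ C₀ → let U = λ v → C₂ :* (v :* v) :+ C₁ :* v :+ C₀ in
           C₂ :* ((x :- y) :* (y :- z) :* (z :- x)) :=
           y :* U z :- z :* U y :- (x :* U z :- z :* U x) :+ (x :* U y :- y :* U x))
           refl x y z (ι c₂) (ι c₁) (ι c₀) ⟩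
    y * u z - z * u y - (x * u z - z * u x) + (x * u y - y * u x)
      ≈⟨ +-cong (+-cong (+-cong (*-congˡ u[z]≈x) (-‿cong (*-congˡ u[y]≈z)))
                        (-‿cong (+-cong (*-congˡ u[z]≈x) (-‿cong (*-congˡ u[x]≈y)))))
                (+-cong (*-congˡ u[y]≈z) (-‿cong (*-congˡ u[x]≈y))) ⟩
    y * x - z * z - (x * x - z * y) + (x * z - y * y) ∎

  module Conjugates (φ[α]≈u[α] : φ α ≈ u α) where

    β γ : Carrier
    β = u α
    γ = - (α + β)

    φ[β]≈u[β] : φ β ≈ u β
    φ[β]≈u[β] = trans (φ-u α) (u-cong φ[α]≈u[α])

    root-of-φ : ∀ {y} → cubic y ≈ 0# → cubic (φ y) ≈ 0#
    root-of-φ {y} cubic[y]≈0 = trans (sym (φ-cubic y)) (trans (φ-cong cubic[y]≈0) φ-0)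

    cubic-β : cubic β ≈ 0#
    cubic-β = trans (cubic-cong (sym φ[α]≈u[α])) (root-of-φ cubic-α)

    α≉β : α ≉ β
    α≉β α≈β = α-not-fixed (trans φ[α]≈u[α] (sym α≈β))

    α-β≉0 : α - β ≉ 0#
    α-β≉0 = α≉β ∘ x-y≈0⇒x≈y

    α²+αβ+β²+a≈0 : α * α + α * β + β * β + ι a ≈ 0#
    α²+αβ+β²+a≈0 = cancel (α-β≉0 ∘ β-α≈0⇒α-β≈0) (begin
      (β - α) * (α * α + α * β + β * β + ι a)  ≈⟨ solve 4 (λ x y A B →
          (y :- x) :* (x :* x :+ x :* y :+ y :* y :+ A) :=
          (y :* y :* y :+ A :* y :+ B) :- (x :* x :* x :+ A :* x :+ B))
          refl α β (ι a) (ι b) ⟩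
      cubic β - cubic α                        ≈⟨ +-cong cubic-β (-‿cong cubic-α) ⟩
      0# - 0#                                  ≈⟨ -‿inverseʳ 0# ⟩
      0#                                       ∎)
      where
      β-α≈0⇒α-β≈0 : β - α ≈ 0# → α - β ≈ 0#
      β-α≈0⇒α-β≈0 β-α≈0 =
        trans (solve 2 (λ x y → x :- y := :- (y :- x)) refl α β) (trans (-‿cong β-α≈0) -0#≈0#)

    cubic-factors : ∀ y → cubic y ≈ (y - α) * (y - β) * (y - γ)
    cubic-factors y = sym (begin
      (y - α) * (y - β) * (y - γ)                 ≈⟨ solve 5 (λ y x z A B →
          (y :- x) :* (y :- z) :* (y :- :- (x :+ z)) :=
          (y :* y :* y :+ A :* y :+ B) :- (x :* x :+ x :* z :+ z :* z :+ A) :* y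
            :+ x :* (x :* x :+ x :* z :+ z :* z :+ A) :- (x :* x :* x :+ A :* x :+ B))
          refl y α β (ι a) (ι b) ⟩
      cubic y - Q * y + α * Q - cubic α
        ≈⟨ +-cong (+-cong (+-congˡ (-‿cong (*-congʳ Q≈0))) (*-congˡ Q≈0)) (-‿cong cubic[α]≈0) ⟩
      cubic y - ι (+ 0) * y + α * ι (+ 0) - ι (+ 0)
        ≈⟨ solve 3 (λ F y x → F :- con (+ 0) :* y :+ x :* con (+ 0) :- con (+ 0) := F) refl (cubic y) y α ⟩
      cubic y                                     ∎)
      where
      Q = α * α + α * β + β * β + ι a
      Q≈0 = trans α²+αβ+β²+a≈0 (sym ι-0)
      cubic[α]≈0 = trans cubic-α (sym ι-0)

    roots-of-cubic : ∀ y → cubic y ≈ 0# → y ≈ α ⊎ y ≈ β ⊎ y ≈ γ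
    roots-of-cubic y cubic[y]≈0 = by-cases (y - α ≈? 0#) (y - β ≈? 0#)
      where
      product≈0 : (y - α) * ((y - β) * (y - γ)) ≈ 0#
      product≈0 = trans (sym (*-assoc _ _ _)) (trans (sym (cubic-factors y)) cubic[y]≈0)
      by-cases : Dec (y - α ≈ 0#) → Dec (y - β ≈ 0#) → y ≈ α ⊎ y ≈ β ⊎ y ≈ γ
      by-cases (yes y-α≈0) _            = inj₁ (x-y≈0⇒x≈y y-α≈0)
      by-cases (no _)     (yes y-β≈0) = inj₂ (inj₁ (x-y≈0⇒x≈y y-β≈0))
      by-cases (no y-α≉0) (no y-β≉0)  = inj₂ (inj₂ (x-y≈0⇒x≈y (cancel y-β≉0 (cancel y-α≉0 product≈0))))

    γ≉ι : ∀ c → γ ≉ ι c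
    γ≉ι c γ≈ι[c] = no-ι-root c (trans (cubic-cong (sym γ≈ι[c])) cubic-γ)
      where
      cubic-γ : cubic γ ≈ 0#
      cubic-γ = trans (cubic-factors γ) (trans (*-congˡ (-‿inverseʳ γ)) (zeroʳ _))

    -- Otherwise γ = -(α + β) would be the constant e / c₂.
    linear-relation : ∀ e → ι c₂ * (α + β) + ι e ≈ 0# → c₂ ≈ₙ + 0 Product.× e ≈ₙ + 0
    linear-relation e relation = by-cases (c₂ ≈ₙ? + 0)
      where
      by-cases : Dec (c₂ ≈ₙ + 0) → c₂ ≈ₙ + 0 Product.× e ≈ₙ + 0
      by-cases (yes c₂≈0) = c₂≈0 , ι-injective (begin
        ι e                     ≈⟨ +-identityˡ _ ⟨
        0# + ι e
          ≈⟨ +-congʳ (trans (sym (zeroˡ _)) (*-congʳ (trans (sym ι-0) (ι-cong (≈ₙ-sym c₂≈0))))) ⟩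
        ι c₂ * (α + β) + ι e    ≈⟨ relation ⟩
        0#                      ≈⟨ ι-0 ⟨
        ι (+ 0)                 ∎)
      by-cases (no c₂≉0) = contradiction γ≈ι[de] (γ≉ι (d ℤ.* e))
        where
        d = proj₁ (ι-invertible c₂≉0)
        γ≈ι[de] : γ ≈ ι (d ℤ.* e)
        γ≈ι[de] = begin
          - (α + β)                  ≈⟨ *-identityˡ _ ⟨
          1# * - (α + β)             ≈⟨ *-congʳ (proj₂ (ι-invertible c₂≉0)) ⟨
          ι d * ι c₂ * - (α + β)
            ≈⟨ solve 4 (λ D C x y → D :* C :* :- (x :+ y) := D :* :- (C :* (x :+ y)))
                                         refl (ι d) (ι c₂) α β ⟩
          ι d * - (ι c₂ * (α + β))   ≈⟨ *-congˡ (inverseʳ-unique _ _ relation) ⟨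
          ι d * ι e                  ≈⟨ ι-* d e ⟨
          ι (d ℤ.* e)                ∎

    u[β]≉β : u β ≉ β
    u[β]≉β u[β]≈β = no-ι-root c₀ (trans (cubic-cong (sym β≈ι[c₀])) cubic-β)
      where
      relation : ι c₂ * (α + β) + ι c₁ ≈ 0#
      relation = cancel α-β≉0 (begin
        (α - β) * (ι c₂ * (α + β) + ι c₁)  ≈⟨ u-difference α β ⟨
        u α - u β                          ≈⟨ +-congˡ (-‿cong u[β]≈β) ⟩
        β - β                              ≈⟨ -‿inverseʳ β ⟩
        0#                                 ∎)
      c₂≈0 = Product.proj₁ (linear-relation c₁ relation)
      c₁≈0 = Product.proj₂ (linear-relation c₁ relation)
      β≈ι[c₀] : β ≈ ι c₀
      β≈ι[c₀] = begin
        ι c₂ * (α * α) + ι c₁ * α + ι c₀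
          ≈⟨ +-congʳ (+-cong (*-congʳ (ι-cong c₂≈0)) (*-congʳ (ι-cong c₁≈0))) ⟩
        ι (+ 0) * (α * α) + ι (+ 0) * α + ι c₀
          ≈⟨ solve 2 (λ x C → con (+ 0) :* (x :* x) :+ con (+ 0) :* x :+ C := C)
                                                     refl α (ι c₀) ⟩
        ι c₀                                     ∎

    u[β]≉α : u β ≉ α
    u[β]≉α u[β]≈α = γ≉ι (ℤ.- c₀) γ≈ι[-c₀]
      where
      relation : ι c₂ * (α + β) + ι (c₁ ℤ.+ + 1) ≈ 0#
      relation = cancel α-β≉0 (begin
        (α - β) * (ι c₂ * (α + β) + ι (c₁ ℤ.+ + 1))     ≈⟨ *-congˡ (+-congˡ (ι-+ c₁ (+ 1))) ⟩
        (α - β) * (ι c₂ * (α + β) + (ι c₁ + ι (+ 1)))   ≈⟨ solve 4 (λ x y C₂ C₁ →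
            (x :- y) :* (C₂ :* (x :+ y) :+ (C₁ :+ con (+ 1))) :=
            (x :- y) :* (C₂ :* (x :+ y) :+ C₁) :+ (x :- y))
            refl α β (ι c₂) (ι c₁) ⟩
        (α - β) * (ι c₂ * (α + β) + ι c₁) + (α - β)     ≈⟨ +-congʳ (u-difference α β) ⟨
        u α - u β + (α - β)                             ≈⟨ +-congʳ (+-congˡ (-‿cong u[β]≈α)) ⟩
        β - α + (α - β)
          ≈⟨ solve 2 (λ x y → y :- x :+ (x :- y) := con (+ 0)) refl α β ⟩
        ι (+ 0)                                         ≈⟨ ι-0 ⟩
        0#                                              ∎)
      c₂≈0 = Product.proj₁ (linear-relation (c₁ ℤ.+ + 1) relation)
      c₁≈-1 : c₁ ≈ₙ ℤ.- + 1
      c₁≈-1 = ≈ₙ-trans (≡⇒≈ₙ (shift c₁))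
        (+-cong-≈ₙ (Product.proj₂ (linear-relation (c₁ ℤ.+ + 1) relation)) (≈ₙ-refl {ℤ.- + 1}))
        where
        shift : ∀ c → c ≡ (c ℤ.+ + 1) ℤ.+ ℤ.- + 1
        shift = solve-∀
      γ≈ι[-c₀] : γ ≈ ι (ℤ.- c₀)
      γ≈ι[-c₀] = begin
        - (α + (ι c₂ * (α * α) + ι c₁ * α + ι c₀))
          ≈⟨ -‿cong (+-congˡ (+-congʳ (+-cong (*-congʳ (ι-cong c₂≈0))
                                              (*-congʳ (trans (ι-cong c₁≈-1) (ι-‿ (+ 1))))))) ⟩
        - (α + (ι (+ 0) * (α * α) + - ι (+ 1) * α + ι c₀))
          ≈⟨ solve 2 (λ x C → :- (x :+ (con (+ 0) :* (x :* x) :+ :- con (+ 1) :* x :+ C)) := :- C) refl α (ι c₀) ⟩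
        - ι c₀                                                  ≈⟨ ι-‿ c₀ ⟨
        ι (ℤ.- c₀)                                              ∎

    u[β]≈γ : u β ≈ γ
    u[β]≈γ = [ contradiction-with u[β]≉α , [ contradiction-with u[β]≉β , (λ u[β]≈γ → u[β]≈γ) ]′ ]′
      (roots-of-cubic (u β) (trans (cubic-cong (sym φ[β]≈u[β])) (root-of-φ cubic-β)))
      where
      contradiction-with : ∀ {x} → u β ≉ x → u β ≈ x → u β ≈ γ
      contradiction-with u[β]≉x u[β]≈x = contradiction u[β]≈x u[β]≉x

    u[γ]≈α : u γ ≈ α
    u[γ]≈α = begin
      u γ            ≈⟨ u-cong (trans (sym u[β]≈γ) (sym φ[β]≈u[β])) ⟩
      u (φ β)        ≈⟨ φ-u β ⟨
      φ (u β)        ≈⟨ φ-cong u[β]≈γ ⟩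
      φ (- (α + β))  ≈⟨ trans (φ-‿ _) (-‿cong (φ-+ α β)) ⟩
      - (φ α + φ β)  ≈⟨ -‿cong (+-cong φ[α]≈u[α] (trans φ[β]≈u[β] u[β]≈γ)) ⟩
      - (β + γ)      ≈⟨ solve 2 (λ x y → :- (y :+ :- (x :+ y)) := x) refl α β ⟩
      α              ∎

    vandermonde : Carrier
    vandermonde = (α - β) * (β - γ) * (γ - α)

    c₂*vandermonde≈3a : ι c₂ * vandermonde ≈ ι (+ 3 ℤ.* a)
    c₂*vandermonde≈3a = begin
      ι c₂ * vandermonde                                   ≈⟨ cyclic-interpolation refl u[β]≈γ u[γ]≈α ⟩
      β * α - γ * γ - (α * α - γ * β) + (α * γ - β * β)    ≈⟨ solve 3 (λ x y A → let z = :- (x :+ y) in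
          y :* x :- z :* z :- (x :* x :- z :* y) :+ (x :* z :- y :* y) :=
          con (+ 3) :* A :- con (+ 3) :* (x :* x :+ x :* y :+ y :* y :+ A))
          refl α β (ι a) ⟩
      ι (+ 3) * ι a - ι (+ 3) * (α * α + α * β + β * β + ι a)
        ≈⟨ +-congˡ (-‿cong (*-congˡ (trans α²+αβ+β²+a≈0 (sym ι-0)))) ⟩
      ι (+ 3) * ι a - ι (+ 3) * ι (+ 0)
        ≈⟨ solve 1 (λ A → con (+ 3) :* A :- con (+ 3) :* con (+ 0) := con (+ 3) :* A) refl (ι a) ⟩
      ι (+ 3) * ι a                                        ≈⟨ ι-* (+ 3) a ⟨
      ι (+ 3 ℤ.* a)                                        ∎

    vandermonde²≈discriminant : vandermonde * vandermonde ≈ ι (ℤ.- (+ 4 ℤ.* a ℤ.^ 3 ℤ.+ + 27 ℤ.* b ℤ.^ 2))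
    vandermonde²≈discriminant = begin
      vandermonde * vandermonde
        ≈⟨ solve 2 (λ x y → let z = :- (x :+ y); V = (x :- y) :* (y :- z) :* (z :- x) in
             V :* V := :- (con (+ 4) :* (:- (x :* x :+ x :* y :+ y :* y)) :^ 3
                            :+ con (+ 27) :* (x :* y :* (x :+ y)) :^ 2))
             refl α β ⟩
      - (ι (+ 4) * (- (α * α + α * β + β * β)) ^ 3 + ι (+ 27) * (α * β * (α + β)) ^ 2)
        ≈⟨ -‿cong (+-cong (*-congˡ (^-congˡ 3 a≈)) (*-congˡ (^-congˡ 2 b≈))) ⟩
      - (ι (+ 4) * ι a ^ 3 + ι (+ 27) * ι b ^ 2)
        ≈⟨ trans (ι-‿ _) (-‿cong (trans (ι-+ _ _) (+-cong
             (trans (ι-* _ _) (*-congˡ (sym (ι-^ a 3)))) (trans (ι-* _ _) (*-congˡ (sym (ι-^ b 2))))))) ⟨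
      ι (ℤ.- (+ 4 ℤ.* a ℤ.^ 3 ℤ.+ + 27 ℤ.* b ℤ.^ 2)) ∎
      where
      a≈ : - (α * α + α * β + β * β) ≈ ι a
      a≈ = sym (inverseʳ-unique _ _ α²+αβ+β²+a≈0)
      b≈ : α * β * (α + β) ≈ ι b
      b≈ = sym (begin
        ι b                                              ≈⟨ inverseʳ-unique _ _ cubic-α ⟩
        - (α * α * α + ι a * α)                          ≈⟨ -‿cong (+-congˡ (*-congʳ (sym a≈))) ⟩
        - (α * α * α + - (α * α + α * β + β * β) * α)
          ≈⟨ solve 2 (λ x y → :- (x :* x :* x :+ :- (x :* x :+ x :* y :+ y :* y) :* x) := x :* y :* (x :+ y))
                                                             refl α β ⟩
        α * β * (α + β)                                  ∎)

    c₂-invertible : ¬ + 3 ℤ.* a ≈ₙ + 0 → ∃[ d ] c₂ ℤ.* d ≈ₙ + 1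
    c₂-invertible 3a≉0 = inverse λ c₂≈0 → 3a≉0 (ι-injective (begin
      ι (+ 3 ℤ.* a)        ≈⟨ c₂*vandermonde≈3a ⟨
      ι c₂ * vandermonde   ≈⟨ *-congʳ (trans (ι-cong c₂≈0) ι-0) ⟩
      0# * vandermonde     ≈⟨ zeroˡ _ ⟩
      0#                   ≈⟨ ι-0 ⟨
      ι (+ 0)              ∎))

    square-root-of-discriminant : ∀ d → c₂ ℤ.* d ≈ₙ + 1 → ∀ t → t ≈ₙ + 3 ℤ.* a ℤ.* d →
                                  t ℤ.^ 2 ≈ₙ ℤ.- (+ 4 ℤ.* a ℤ.^ 3 ℤ.+ + 27 ℤ.* b ℤ.^ 2)
    square-root-of-discriminant d c₂d≈1 t t≈3ad = ι-injective (begin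
      ι (t ℤ.^ 2)                 ≈⟨ ι-^ t 2 ⟨
      ι t ^ 2                     ≈⟨ ^-congˡ 2 ι[t]≈vandermonde ⟩
      vandermonde ^ 2             ≈⟨ *-congˡ (*-identityʳ _) ⟩
      vandermonde * vandermonde   ≈⟨ vandermonde²≈discriminant ⟩
      ι (ℤ.- (+ 4 ℤ.* a ℤ.^ 3 ℤ.+ + 27 ℤ.* b ℤ.^ 2)) ∎)
      where
      ι[t]≈vandermonde : ι t ≈ vandermonde
      ι[t]≈vandermonde = begin
        ι t                        ≈⟨ ι-cong t≈3ad ⟩
        ι (+ 3 ℤ.* a ℤ.* d)        ≈⟨ ι-* _ d ⟩
        ι (+ 3 ℤ.* a) * ι d        ≈⟨ *-congʳ c₂*vandermonde≈3a ⟨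
        ι c₂ * vandermonde * ι d
          ≈⟨ solve 3 (λ C V D → C :* V :* D := C :* D :* V) refl (ι c₂) vandermonde (ι d) ⟩
        ι c₂ * ι d * vandermonde   ≈⟨ *-congʳ (trans (sym (ι-* c₂ d)) (trans (ι-cong c₂d≈1) ι-1)) ⟩
        1# * vandermonde           ≈⟨ *-identityˡ _ ⟩
        vandermonde                ∎

open import Defs
open import Data.Nat using (ℕ; _≤_)
open import Data.Nat.Primality using (Prime)
open import Data.Integer using (ℤ; +_; _*_; -_; _+_; _^_)
open import Data.Integer.GCD using (gcd)
open import Data.List using ([]; _∷_)
open import Data.Product using (Σ; _×_)
import Relation.Binary.PropositionalEquality as Eq

open import Data.Nat using (s≤s; z≤n)
import Data.Nat.Properties as ℕ
open import Data.Product using (map₂)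
open import Data.Sum using ([_,_]′)
open import Relation.Nullary using (¬_)

theorem2 : (p : ℕ) → Prime p → 5 ≤ p → (a b : ℤ) → gcd a (+ p) Eq.≡ + 1 →
    IrreducibleModₚ p (b ∷ a ∷ + 0 ∷ + 1 ∷ []) →
    (c₀ c₁ c₂ : ℤ) →
    X^ p ≡ (c₀ ∷ c₁ ∷ c₂ ∷ []) [modₚ p , b ∷ a ∷ + 0 ∷ + 1 ∷ [] ] →
    Σ ℤ (λ d → c₂ * d ≡ + 1 [mod p ])
    × (∀ d → c₂ * d ≡ + 1 [mod p ] → ∀ t → t ≡ (+ 3 * a) * d [mod p ] →
         t ^ 2 ≡ - ((+ 4 * a ^ 3) + (+ 27 * b ^ 2)) [mod p ])
theorem2 p p-prime 5≤p a b gcd[a,p]≡1 irreducible c₀ c₁ c₂ xᵖ≡c =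
    map₂ unmod (c₂-invertible 3a≉0)
  , λ d c₂d≡1 t t≡3ad → unmod (square-root-of-discriminant d (mod c₂d≡1) t (mod t≡3ad))
  where
  open PrimeModulus p p-prime
  open Orbit p p-prime a b (IntegerPolynomials.irreducible⇒no-root p p-prime irreducible) c₀ c₁ c₂
  open Conjugates (Evaluation.frobenius-of-α p p-prime a b xᵖ≡c)
  3≉0 : ¬ + 3 ≈ₙ + 0
  3≉0 = 0<n<p⇒p∤n (s≤s z≤n) (ℕ.≤-trans (ℕ.n≤1+n 4) 5≤p) ∘ ≈0⇒p∣
  3a≉0 : ¬ + 3 * a ≈ₙ + 0
  3a≉0 = [ 3≉0 , coprime⇒≉0 gcd[a,p]≡1 ]′ ∘ x*y≈0⇒x≈0⊎y≈0 (+ 3) a
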